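{- Let $R=R_1\times R_2\times\cdots\times R_s$, where each $R_i$ is a finite local ring with maximal ideal $M_i$ of order $m_i$, and where $|R_1|/m_1\le\cdots\le |R_s|/m_s$. Then the numbers of $4$-cycles in $G_R$ and in its line graph are $$n_4(G_R)=\frac18|R^\times||R|\left(1-2|R^\times|+\prod_{i=1}^s\left(|R_i^\times|^2-|R_i^\times|m_i+m_i^2\right)\right),$$ $$n_4(\mathcal{L}(G_R))=\frac18|R^\times||R|\left(|R^\times|(|R^\times|-3)^2-5+4(|R^\times|-2)\prod_{i=1}^s\left(|R_i^\times|-m_i\right)+\prod_{i=1}^s\left(|R_i^\times|^2-|R_i^\times|m_i+m_i^2\right)\right).$$
   Context: Rings are commutative with identity $1\neq 0$. For a finite commutative ring $R$, $R^\times$ denotes its group of units. The unitary Cayley graph $G_R$ is the graph with vertex set $R$ in which $x,y\in R$ are adjacent iff $x-y\in R^\times$. A local ring is a commutative ring with a unique maximal ideal. The line graph $\mathcal{L}(G)$ of a graph $G$ has the edges of $G$ as vertices, two being adjacent iff they share an end-vertex. $n_4(G)$ denotes the number of quadrangles ($4$-cycles) in a graph $G$. -}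

module Defs where

open import Level using (0ℓ)
open import Data.Nat as ℕ using (ℕ; zero; suc; _/_)
open import Data.Integer as ℤ using (ℤ; +_)
open import Data.Bool using (Bool; true; false; _∧_; _∨_; not)
open import Data.Fin using (Fin; zero; suc; _≟_)
open import Data.Fin.Subset using (Subset; _∈_; _⊆_; ⊤; ∣_∣)
open import Data.List using (List; []; _∷_; [_]; _++_; map; concatMap; allFin; filterᵇ; length)
open import Data.Bool.ListAction using (all; any)
open import Data.Nat.ListAction using (sum)
open import Data.Product using (Σ; _×_; _,_)
open import Data.Sum using (_⊎_)
open import Relation.Nullary using (¬_)
open import Relation.Nullary.Decidable using (⌊_⌋)
open import Relation.Binary.PropositionalEquality using (_≡_; _≢_)
open import Algebra.Structures using (IsCommutativeRing)

record FinCRing (n : ℕ) : Set where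
  field
    _+_ _*_ : Fin n → Fin n → Fin n
    -_      : Fin n → Fin n
    0# 1#   : Fin n
    isCommutativeRing : IsCommutativeRing _≡_ _+_ _*_ -_ 0# 1#
    1≢0     : 1# ≢ 0#

module _ {n : ℕ} (R : FinCRing n) where
  open FinCRing R

  isUnitᵇ : Fin n → Bool
  isUnitᵇ x = any (λ y → ⌊ x * y ≟ 1# ⌋) (allFin n)

  unitCount : ℕ
  unitCount = length (filterᵇ isUnitᵇ (allFin n))

  record IsIdeal (I : Subset n) : Set where
    field
      zero∈ : 0# ∈ I
      +-closed : ∀ x y → x ∈ I → y ∈ I → (x + y) ∈ I
      neg-closed : ∀ x → x ∈ I → (- x) ∈ I
      mul-closed : ∀ r x → x ∈ I → (r * x) ∈ I

  record IsMaximalIdeal (I : Subset n) : Set where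
    field
      ideal : IsIdeal I
      proper : I ≢ ⊤
      maximal : ∀ J → IsIdeal J → I ⊆ J → J ≡ I ⊎ J ≡ ⊤

  IsLocalWithMaximalIdeal : Subset n → Set
  IsLocalWithMaximalIdeal M = IsMaximalIdeal M × (∀ J → IsMaximalIdeal J → J ≡ M)

-- Finite graphs given by a list of vertices (without repetition, covering
-- the vertex type), a Boolean equality and a Boolean adjacency relation.

countᵇ : {A : Set} → (A → Bool) → List A → ℕ
countᵇ p xs = length (filterᵇ p xs)

-- number of ordered 4-tuples (a,b,c,d) of pairwise distinct vertices
-- with a~b~c~d~a (each quadrangle is counted 8 times)
closedWalks4 : {V : Set} → List V → (V → V → Bool) → (V → V → Bool) → ℕ
closedWalks4 vs eq adj =
  sum (map (λ a → sum (map (λ b → sum (map (λ c → countᵇ (λ d →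
      not (eq a b) ∧ not (eq a c) ∧ not (eq a d) ∧ not (eq b c) ∧ not (eq b d) ∧ not (eq c d)
      ∧ adj a b ∧ adj b c ∧ adj c d ∧ adj d a) vs) vs)) vs)) vs)

n₄ : {V : Set} → List V → (V → V → Bool) → (V → V → Bool) → ℕ
n₄ vs eq adj = closedWalks4 vs eq adj / 8

-- edges {x,y} listed once each, as (x , y) with x before y in vs
edgesOf : {V : Set} → List V → (V → V → Bool) → List (V × V)
edgesOf [] adj = []
edgesOf (x ∷ xs) adj = map (λ y → (x , y)) (filterᵇ (adj x) xs) ++ edgesOf xs adj

eqEdge : {V : Set} → (V → V → Bool) → V × V → V × V → Bool
eqEdge eq (x , y) (x' , y') = eq x x' ∧ eq y y'

adjLine : {V : Set} → (V → V → Bool) → V × V → V × V → Bool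
adjLine eq e@(x , y) e'@(x' , y') =
  not (eqEdge eq e e') ∧ (eq x x' ∨ eq x y' ∨ eq y x' ∨ eq y y')

n₄Line : {V : Set} → List V → (V → V → Bool) → (V → V → Bool) → ℕ
n₄Line vs eq adj = n₄ (edgesOf vs adj) (eqEdge eq) (adjLine eq)

Prod : (s : ℕ) → (Fin s → ℕ) → Set
Prod s n = (i : Fin s) → Fin (n i)

consP : {s : ℕ} {n : Fin (suc s) → ℕ} → Fin (n zero) → ((i : Fin s) → Fin (n (suc i))) → Prod (suc s) n
consP a f zero = a
consP a f (suc i) = f i

enumProd : (s : ℕ) (n : Fin s → ℕ) → List (Prod s n)
enumProd zero n = [ (λ ()) ]
enumProd (suc s) n =
  concatMap (λ a → map (λ f → consP {s} {n} a f) (enumProd s (λ i → n (suc i)))) (allFin (n zero))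

module _ {s : ℕ} {n : Fin s → ℕ} (R : (i : Fin s) → FinCRing (n i)) where

  eqP : Prod s n → Prod s n → Bool
  eqP x y = all (λ i → ⌊ x i ≟ y i ⌋) (allFin s)

  subP : Prod s n → Prod s n → Prod s n
  subP x y i = FinCRing._+_ (R i) (x i) (FinCRing.-_ (R i) (y i))

  mulP : Prod s n → Prod s n → Prod s n
  mulP x y i = FinCRing._*_ (R i) (x i) (y i)

  oneP : Prod s n
  oneP i = FinCRing.1# (R i)

  isUnitPᵇ : Prod s n → Bool
  isUnitPᵇ x = any (λ y → eqP (mulP x y) oneP) (enumProd s n)

  adjCayley : Prod s n → Prod s n → Bool
  adjCayley x y = isUnitPᵇ (subP x y)

  cardP : ℕ
  cardP = length (enumProd s n)

  unitCountP : ℕ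
  unitCountP = countᵇ isUnitPᵇ (enumProd s n)

  n₄Cayley : ℕ
  n₄Cayley = n₄ (enumProd s n) eqP adjCayley

  n₄LineCayley : ℕ
  n₄LineCayley = n₄Line (enumProd s n) eqP adjCayley

∏ : (s : ℕ) → (Fin s → ℤ) → ℤ
∏ zero f = + 1
∏ (suc s) f = f zero ℤ.* ∏ s (λ i → f (suc i))

module Submission where

-- Quadrangles in the unitary Cayley graph G_R of R = R₁ × ⋯ × Rₛ (Rᵢ finite
-- local with maximal ideal Mᵢ) and in its line graph, counted with integer
-- sums ∑ over finite lists and Iverson brackets ⟦ b ⟧.
--  1. In any finite graph, 8·n₄ is the number of closed 4-walks a~b~c~d~a with
--     distinct vertices, which is ∑_{a ≠ c} (λ(a,c)² − λ(a,c)) for λ the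
--     number of common neighbours; divisibility by 8 uses a total order.
--  2. For a k-regular graph on N vertices this expresses n₄(G) by N, k and
--     T₄ = ∑ λ², and n₄(L(G)) by N, k, T₄ and the number T₃ of closed 3-walks,
--     since common neighbours of two edges in L(G) are determined by the
--     coincidences and adjacencies of their end-vertices.
--  3. In a finite local ring the units are the elements outside M, whence
--     λ(a,c) = |R| − 2|M| + |M|·[a − c ∈ M]; this evaluates T₃, T₄ for G_{Rᵢ}.
--  4. Adjacency in G_R is the product of the adjacencies in the G_{Rᵢ}, so all
--     parameters factorise, and the formulas follow by ring normalisation.

open import Data.Bool using (Bool; true; false; _∧_; _∨_; not)
open import Data.Bool.Properties using (∧-zeroʳ; ∨-identityʳ) renaming (_≟_ to _≟𝔹_)
open import Data.Nat as ℕ using (ℕ; zero; suc; _∸_)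
import Data.Nat.Properties as ℕP
open import Data.Nat.DivMod using (m*n/n≡m)
open import Data.Integer using (ℤ; +_; _+_; _-_; _*_; -_; 0ℤ; 1ℤ)
open import Data.Integer.Properties
  using (+-identityˡ; +-identityʳ; +-comm; +-assoc; *-identityˡ; *-identityʳ; *-zeroˡ; *-zeroʳ;
         *-comm; *-assoc; *-distribˡ-+; neg-distrib-+; pos-+; pos-*; +-injective; *-cancelˡ-≡)
open import Data.Integer.Tactic.RingSolver using (solve-∀)
open import Data.Fin as Fin using (Fin; zero; suc; _≟_)
open import Data.Fin.Properties using (all?)
open import Data.Fin.Subset using (Subset; _∉_; _⊆_; _⊂_; ⊤; ∣_∣) renaming (_∈_ to _∈ˢ_)
open import Data.Fin.Subset.Properties using (_∈?_; _⊂?_; p⊂q⇒∣p∣<∣q∣; ∣p∣≤n; ⊆-antisym; ∈⊤)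
open import Data.Vec as Vec using ([]; _∷_; lookup; tabulate)
import Data.Vec.Properties as VecP
open import Data.List as List using (List; []; _∷_; map; _++_; filterᵇ; length; concatMap; allFin)
open import Data.List.Membership.Propositional using (_∈_)
open import Data.List.Membership.Propositional.Properties using (∈-allFin; ∈-++⁻)
open import Data.List.Relation.Unary.Any as Any using (here; there; any?)
open import Data.List.Relation.Unary.Any.Properties using (++⁺ˡ; ++⁺ʳ; map⁺)
open import Data.Bool.ListAction using (all; any)
open import Data.Nat.ListAction using (sum)
open import Data.Product using (Σ; _×_; _,_; proj₁; proj₂)
open import Data.Sum using (_⊎_; inj₁; inj₂)
open import Data.Empty using (⊥; ⊥-elim)
open import Function using (_∘_)
open import Relation.Nullary using (Dec; yes; no; ¬_)
open import Relation.Nullary.Decidable using (⌊_⌋; _×-dec_; _→-dec_; ¬?)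
open import Relation.Binary.PropositionalEquality
open import Algebra.Structures using (IsCommutativeRing)
open import Defs

∑ : {A : Set} → List A → (A → ℤ) → ℤ
∑ [] f = 0ℤ
∑ (x ∷ xs) f = f x + ∑ xs f

⟦_⟧ : Bool → ℤ
⟦ true ⟧ = 1ℤ
⟦ false ⟧ = 0ℤ

module _ {A : Set} where

  ∑-cong : (xs : List A) {f g : A → ℤ} → (∀ x → f x ≡ g x) → ∑ xs f ≡ ∑ xs g
  ∑-cong [] e = refl
  ∑-cong (x ∷ xs) e = cong₂ _+_ (e x) (∑-cong xs e)

  ∑-cong-∈ : (xs : List A) {f g : A → ℤ} → (∀ x → x ∈ xs → f x ≡ g x) → ∑ xs f ≡ ∑ xs g
  ∑-cong-∈ [] e = refl
  ∑-cong-∈ (x ∷ xs) e = cong₂ _+_ (e x (here refl)) (∑-cong-∈ xs (λ y m → e y (there m)))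

  ∑-+ : (xs : List A) (f g : A → ℤ) → ∑ xs (λ x → f x + g x) ≡ ∑ xs f + ∑ xs g
  ∑-+ [] f g = refl
  ∑-+ (x ∷ xs) f g = trans (cong (_+_ (f x + g x)) (∑-+ xs f g)) (interchange (f x) (g x) (∑ xs f) (∑ xs g))
    where interchange : ∀ a b c d → a + b + (c + d) ≡ a + c + (b + d)
          interchange = solve-∀

  ∑-0 : (xs : List A) → ∑ xs (λ _ → 0ℤ) ≡ 0ℤ
  ∑-0 [] = refl
  ∑-0 (x ∷ xs) = trans (+-identityˡ _) (∑-0 xs)

  ∑-*ˡ : (xs : List A) (c : ℤ) (f : A → ℤ) → ∑ xs (λ x → c * f x) ≡ c * ∑ xs f
  ∑-*ˡ [] c f = sym (*-zeroʳ c)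
  ∑-*ˡ (x ∷ xs) c f = trans (cong (_+_ (c * f x)) (∑-*ˡ xs c f)) (sym (*-distribˡ-+ c (f x) (∑ xs f)))

  ∑-*ʳ : (xs : List A) (c : ℤ) (f : A → ℤ) → ∑ xs (λ x → f x * c) ≡ ∑ xs f * c
  ∑-*ʳ xs c f = trans (∑-cong xs (λ x → *-comm (f x) c)) (trans (∑-*ˡ xs c f) (*-comm c (∑ xs f)))

  ∑-neg : (xs : List A) (f : A → ℤ) → ∑ xs (λ x → - f x) ≡ - ∑ xs f
  ∑-neg [] f = refl
  ∑-neg (x ∷ xs) f = trans (cong (_+_ (- f x)) (∑-neg xs f)) (sym (neg-distrib-+ (f x) (∑ xs f)))

  ∑-- : (xs : List A) (f g : A → ℤ) → ∑ xs (λ x → f x - g x) ≡ ∑ xs f - ∑ xs g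
  ∑-- xs f g = trans (∑-+ xs f (λ x → - g x)) (cong (_+_ (∑ xs f)) (∑-neg xs g))

  ∑-++ : (xs ys : List A) (f : A → ℤ) → ∑ (xs ++ ys) f ≡ ∑ xs f + ∑ ys f
  ∑-++ [] ys f = sym (+-identityˡ _)
  ∑-++ (x ∷ xs) ys f = trans (cong (_+_ (f x)) (∑-++ xs ys f)) (sym (+-assoc (f x) (∑ xs f) (∑ ys f)))

  ∑-filter : (p : A → Bool) (xs : List A) (f : A → ℤ) → ∑ (filterᵇ p xs) f ≡ ∑ xs (λ x → ⟦ p x ⟧ * f x)
  ∑-filter p [] f = refl
  ∑-filter p (x ∷ xs) f with p x
  ... | true = cong₂ _+_ (sym (*-identityˡ (f x))) (∑-filter p xs f)
  ... | false = trans (∑-filter p xs f) (sym (+-identityˡ _))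

  count≡∑ : (p : A → Bool) (xs : List A) → + length (filterᵇ p xs) ≡ ∑ xs (λ x → ⟦ p x ⟧)
  count≡∑ p [] = refl
  count≡∑ p (x ∷ xs) with p x
  ... | true = cong (_+_ (1ℤ)) (count≡∑ p xs)
  ... | false = trans (count≡∑ p xs) (sym (+-identityˡ _))

  length≡∑ : (xs : List A) → + length xs ≡ ∑ xs (λ _ → 1ℤ)
  length≡∑ [] = refl
  length≡∑ (x ∷ xs) = trans (pos-+ 1 (length xs)) (cong (_+_ (1ℤ)) (length≡∑ xs))

  ∑⟦⟧≡1⇒witness : (xs : List A) (p : A → Bool) → ∑ xs (λ x → ⟦ p x ⟧) ≡ 1ℤ → Σ A (λ y → y ∈ xs × p y ≡ true)
  ∑⟦⟧≡1⇒witness [] p ()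
  ∑⟦⟧≡1⇒witness (x ∷ xs) p e with p x in px
  ... | true = x , here refl , px
  ... | false with ∑⟦⟧≡1⇒witness xs p (trans (sym (+-identityˡ _)) e)
  ... | y , y∈ , py = y , there y∈ , py

module _ {A B : Set} where

  ∑-swap : (xs : List A) (ys : List B) (f : A → B → ℤ) →
    ∑ xs (λ x → ∑ ys (λ y → f x y)) ≡ ∑ ys (λ y → ∑ xs (λ x → f x y))
  ∑-swap [] ys f = sym (∑-0 ys)
  ∑-swap (x ∷ xs) ys f =
    trans (cong (_+_ (∑ ys (f x))) (∑-swap xs ys f)) (sym (∑-+ ys (f x) (λ y → ∑ xs (λ x' → f x' y))))

  ∑-map : (g : A → B) (xs : List A) (f : B → ℤ) → ∑ (map g xs) f ≡ ∑ xs (λ x → f (g x))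
  ∑-map g [] f = refl
  ∑-map g (x ∷ xs) f = cong (_+_ (f (g x))) (∑-map g xs f)

  ∑-concatMap : (g : A → List B) (xs : List A) (f : B → ℤ) → ∑ (concatMap g xs) f ≡ ∑ xs (λ x → ∑ (g x) f)
  ∑-concatMap g [] f = refl
  ∑-concatMap g (x ∷ xs) f = trans (∑-++ (g x) (concatMap g xs) f) (cong (_+_ (∑ (g x) f)) (∑-concatMap g xs f))

  ∑-product : (xs : List A) (ys : List B) (f : A → ℤ) (g : B → ℤ) → ∑ xs f * ∑ ys g ≡ ∑ xs (λ a → ∑ ys (λ b → f a * g b))
  ∑-product xs ys f g = trans (sym (∑-*ʳ xs (∑ ys g) f)) (∑-cong xs (λ a → sym (∑-*ˡ ys (f a) g)))

sum≡∑ : {A : Set} (xs : List A) (g : A → ℕ) → + sum (map g xs) ≡ ∑ xs (λ x → + g x)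
sum≡∑ [] g = refl
sum≡∑ (x ∷ xs) g = trans (pos-+ (g x) (sum (map g xs))) (cong (_+_ (+ g x)) (sum≡∑ xs g))

⟦∧⟧ : ∀ a b → ⟦ a ∧ b ⟧ ≡ ⟦ a ⟧ * ⟦ b ⟧
⟦∧⟧ true b = sym (*-identityˡ ⟦ b ⟧)
⟦∧⟧ false b = refl

⟦not⟧ : ∀ a → ⟦ not a ⟧ ≡ 1ℤ - ⟦ a ⟧
⟦not⟧ true = refl
⟦not⟧ false = refl

⟦⟧-idem : ∀ a → ⟦ a ⟧ * ⟦ a ⟧ ≡ ⟦ a ⟧
⟦⟧-idem true = refl
⟦⟧-idem false = refl

⟦⟧-injective : ∀ {a b} → ⟦ a ⟧ ≡ ⟦ b ⟧ → a ≡ b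
⟦⟧-injective {true} {true} e = refl
⟦⟧-injective {false} {false} e = refl

∑⁴ : {V : Set} → List V → (V → V → V → V → ℤ) → ℤ
∑⁴ xs f = ∑ xs (λ a → ∑ xs (λ b → ∑ xs (λ c → ∑ xs (λ d → f a b c d))))

module _ {V : Set} (xs : List V) where

  ∑⁴-cong : {f g : V → V → V → V → ℤ} → (∀ a b c d → f a b c d ≡ g a b c d) → ∑⁴ xs f ≡ ∑⁴ xs g
  ∑⁴-cong e = ∑-cong xs (λ a → ∑-cong xs (λ b → ∑-cong xs (λ c → ∑-cong xs (λ d → e a b c d))))

  ∑⁴-+ : (f g : V → V → V → V → ℤ) → ∑⁴ xs (λ a b c d → f a b c d + g a b c d) ≡ ∑⁴ xs f + ∑⁴ xs g
  ∑⁴-+ f g = trans (∑-cong xs (λ a → trans (∑-cong xs (λ b → trans (∑-cong xs (λ c → ∑-+ xs (f a b c) (g a b c)))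
                (∑-+ xs _ _))) (∑-+ xs _ _))) (∑-+ xs _ _)

  ∑⁴-*ˡ : (c : ℤ) (f : V → V → V → V → ℤ) → ∑⁴ xs (λ a b x y → c * f a b x y) ≡ c * ∑⁴ xs f
  ∑⁴-*ˡ c f = trans (∑-cong xs (λ a → trans (∑-cong xs (λ b → trans (∑-cong xs (λ x → ∑-*ˡ xs c (f a b x)))
                (∑-*ˡ xs c _))) (∑-*ˡ xs c _))) (∑-*ˡ xs c _)

  ∑⁴-swap-ab : (f : V → V → V → V → ℤ) → ∑⁴ xs (λ a b c d → f b a c d) ≡ ∑⁴ xs f
  ∑⁴-swap-ab f = ∑-swap xs xs (λ a b → ∑ xs (λ c → ∑ xs (λ d → f b a c d)))

  ∑⁴-swap-cd : (f : V → V → V → V → ℤ) → ∑⁴ xs (λ a b c d → f a b d c) ≡ ∑⁴ xs f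
  ∑⁴-swap-cd f = ∑-cong xs (λ a → ∑-cong xs (λ b → ∑-swap xs xs (λ c d → f a b d c)))

  ∑⁴-swap-bd : (f : V → V → V → V → ℤ) → ∑⁴ xs (λ a b c d → f a d c b) ≡ ∑⁴ xs f
  ∑⁴-swap-bd f = ∑-cong xs (λ a → trans (∑-cong xs (λ b → ∑-swap xs xs (λ c d → f a d c b)))
    (trans (∑-swap xs xs (λ b d → ∑ xs (λ c → f a d c b))) (∑-cong xs (λ d → ∑-swap xs xs (λ b c → f a d c b)))))

  ∑⁴-swap-ac : (f : V → V → V → V → ℤ) → ∑⁴ xs (λ a b c d → f c b a d) ≡ ∑⁴ xs f
  ∑⁴-swap-ac f = trans (∑-cong xs (λ a → ∑-swap xs xs (λ b c → ∑ xs (λ d → f c b a d))))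
    (trans (∑-swap xs xs (λ a c → ∑ xs (λ b → ∑ xs (λ d → f c b a d))))
      (∑-cong xs (λ c → ∑-swap xs xs (λ a b → ∑ xs (λ d → f c b a d)))))

  ∑⁴-swap-ab-cd : (f : V → V → V → V → ℤ) → ∑⁴ xs (λ a b c d → f b a d c) ≡ ∑⁴ xs f
  ∑⁴-swap-ab-cd f = trans (∑-swap xs xs (λ a b → ∑ xs (λ c → ∑ xs (λ d → f b a d c))))
    (∑-cong xs (λ b → ∑-cong xs (λ a → ∑-swap xs xs (λ c d → f b a d c))))

IsNat : ℤ → Set
IsNat z = Σ ℕ (λ k → z ≡ + k)

IsNat-+ : ∀ {x y} → IsNat x → IsNat y → IsNat (x + y)
IsNat-+ (k , refl) (l , refl) = k ℕ.+ l , sym (pos-+ k l)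

IsNat-* : ∀ {x y} → IsNat x → IsNat y → IsNat (x * y)
IsNat-* (k , refl) (l , refl) = k ℕ.* l , sym (pos-* k l)

IsNat-⟦⟧ : ∀ b → IsNat ⟦ b ⟧
IsNat-⟦⟧ true = 1 , refl
IsNat-⟦⟧ false = 0 , refl

IsNat-∑ : {A : Set} (xs : List A) (f : A → ℤ) → (∀ x → IsNat (f x)) → IsNat (∑ xs f)
IsNat-∑ [] f h = 0 , refl
IsNat-∑ (x ∷ xs) f h = IsNat-+ (h x) (IsNat-∑ xs f h)

-- Boolean core of the quadrangle condition: along a closed walk a~b~c~d~a
-- the conditions a≠b, b≠c, c≠d, d≠a follow from irreflexivity of adjacency.
walk-distinctness : ∀ ab ac ad bc bd cd w → (w ≡ true → ab ≡ false × bc ≡ false × cd ≡ false × ad ≡ false) →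
  (not ab ∧ not ac ∧ not ad ∧ not bc ∧ not bd ∧ not cd ∧ w) ≡ (not ac ∧ not bd ∧ w)
walk-distinctness ab ac ad bc bd cd false _
  rewrite ∧-zeroʳ (not cd) | ∧-zeroʳ (not bd) | ∧-zeroʳ (not bc) | ∧-zeroʳ (not ad) | ∧-zeroʳ (not ac) | ∧-zeroʳ (not ab) = refl
walk-distinctness ab ac ad bc bd cd true h with h refl
... | refl , refl , refl , refl with ac
...   | true = refl
...   | false = refl

⟦∧⟧⁴ : ∀ x y z u → ⟦ x ∧ y ∧ z ∧ u ⟧ ≡ (⟦ x ⟧ * ⟦ y ⟧) * (⟦ z ⟧ * ⟦ u ⟧)
⟦∧⟧⁴ x y z u = trans (⟦∧⟧ x _) (trans (cong (⟦ x ⟧ *_) (trans (⟦∧⟧ y _) (cong (⟦ y ⟧ *_) (⟦∧⟧ z u))))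
  (reassoc ⟦ x ⟧ ⟦ y ⟧ ⟦ z ⟧ ⟦ u ⟧))
  where reassoc : ∀ p q r s → p * (q * (r * s)) ≡ (p * q) * (r * s)
        reassoc = solve-∀

-- The vertices are listed by vs, every
-- vertex of vs occurring once up to the Boolean equivalence eq (delta);
-- adjacency is symmetric, irreflexive and respects eq.
module ClosedWalks {V : Set} (vs : List V) (eq adj : V → V → Bool)
  (eq-sym : ∀ a b → eq a b ≡ eq b a)
  (delta : ∀ a → a ∈ vs → ∑ vs (λ y → ⟦ eq a y ⟧) ≡ 1ℤ)
  (adj-sym : ∀ a b → adj a b ≡ adj b a)
  (adj-irr : ∀ a b → adj a b ≡ true → eq a b ≡ false)
  (adj-resp : ∀ a b c → eq a b ≡ true → adj a c ≡ adj b c)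
  where

  Respects : (V → ℤ) → Set
  Respects f = ∀ a b → eq a b ≡ true → f a ≡ f b

  collapse-at : ∀ a → ∑ vs (λ y → ⟦ eq a y ⟧) ≡ 1ℤ → (f : V → ℤ) → Respects f → ∑ vs (λ y → ⟦ eq a y ⟧ * f y) ≡ f a
  collapse-at a δa f rf = begin
      ∑ vs (λ y → ⟦ eq a y ⟧ * f y)   ≡⟨ ∑-cong vs at-a ⟩
      ∑ vs (λ y → ⟦ eq a y ⟧ * f a)   ≡⟨ ∑-*ʳ vs (f a) (λ y → ⟦ eq a y ⟧) ⟩
      ∑ vs (λ y → ⟦ eq a y ⟧) * f a   ≡⟨ cong (_* f a) δa ⟩
      1ℤ * f a                         ≡⟨ *-identityˡ (f a) ⟩
      f a                              ∎
    where
    open ≡-Reasoning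
    at-a : ∀ y → ⟦ eq a y ⟧ * f y ≡ ⟦ eq a y ⟧ * f a
    at-a y with eq a y in e
    ... | true = cong (1ℤ *_) (sym (rf a y e))
    ... | false = refl

  collapse : ∀ a → a ∈ vs → (f : V → ℤ) → Respects f → ∑ vs (λ y → ⟦ eq a y ⟧ * f y) ≡ f a
  collapse a a∈ = collapse-at a (delta a a∈)

  ∑-off-diagonal : (F : V → V → ℤ) → (∀ a → Respects (F a)) →
    ∑ vs (λ a → ∑ vs (λ c → ⟦ not (eq a c) ⟧ * F a c)) ≡ ∑ vs (λ a → ∑ vs (λ c → F a c)) - ∑ vs (λ a → F a a)
  ∑-off-diagonal F rF = trans (∑-cong-∈ vs row) (∑-- vs (λ a → ∑ vs (F a)) (λ a → F a a))
    where
    split : ∀ e f → (1ℤ - e) * f ≡ f - e * f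
    split = solve-∀
    row : ∀ a → a ∈ vs → ∑ vs (λ c → ⟦ not (eq a c) ⟧ * F a c) ≡ ∑ vs (F a) - F a a
    row a a∈ = trans (∑-cong vs (λ c → trans (cong (_* F a c) (⟦not⟧ (eq a c))) (split ⟦ eq a c ⟧ (F a c))))
      (trans (∑-- vs (F a) (λ c → ⟦ eq a c ⟧ * F a c)) (cong (_-_ (∑ vs (F a))) (collapse a a∈ (F a) (rF a))))

  A : V → V → ℤ
  A a b = ⟦ adj a b ⟧

  A-sym : ∀ a b → A a b ≡ A b a
  A-sym a b = cong ⟦_⟧ (adj-sym a b)

  adj-respʳ : ∀ a b c → eq a b ≡ true → adj c a ≡ adj c b
  adj-respʳ a b c e = trans (adj-sym c a) (trans (adj-resp a b c e) (adj-sym b c))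

  common : V → V → ℤ
  common a c = ∑ vs (λ b → A a b * A b c)

  Ne : V → V → ℤ
  Ne a b = ⟦ not (eq a b) ⟧

  Ne-sym : ∀ a b → Ne a b ≡ Ne b a
  Ne-sym a b = cong (λ z → ⟦ not z ⟧) (eq-sym a b)

  quad : V → V → V → V → ℤ
  quad a b c d = Ne a c * (Ne b d * ((A a b * A b c) * (A c d * A d a)))

  quad-indicator : ∀ a b c d →
    ⟦ not (eq a b) ∧ not (eq a c) ∧ not (eq a d) ∧ not (eq b c) ∧ not (eq b d) ∧ not (eq c d)
      ∧ adj a b ∧ adj b c ∧ adj c d ∧ adj d a ⟧ ≡ quad a b c d
  quad-indicator a b c d = begin
      ⟦ not (eq a b) ∧ not (eq a c) ∧ not (eq a d) ∧ not (eq b c) ∧ not (eq b d) ∧ not (eq c d) ∧ walk ⟧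
    ≡⟨ cong ⟦_⟧ (walk-distinctness (eq a b) (eq a c) (eq a d) (eq b c) (eq b d) (eq c d) walk on-walk) ⟩
      ⟦ not (eq a c) ∧ not (eq b d) ∧ walk ⟧
    ≡⟨ trans (⟦∧⟧ (not (eq a c)) _) (cong (⟦ not (eq a c) ⟧ *_) (⟦∧⟧ (not (eq b d)) walk)) ⟩
      ⟦ not (eq a c) ⟧ * (⟦ not (eq b d) ⟧ * ⟦ walk ⟧)
    ≡⟨ cong (λ z → ⟦ not (eq a c) ⟧ * (⟦ not (eq b d) ⟧ * z)) (⟦∧⟧⁴ (adj a b) (adj b c) (adj c d) (adj d a)) ⟩
      quad a b c d ∎
    where
    open ≡-Reasoning
    walk : Bool
    walk = adj a b ∧ adj b c ∧ adj c d ∧ adj d a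
    on-walk : walk ≡ true → eq a b ≡ false × eq b c ≡ false × eq c d ≡ false × eq a d ≡ false
    on-walk w with adj a b in e1 | adj b c in e2 | adj c d in e3 | adj d a in e4
    on-walk refl | true | true | true | true =
      adj-irr a b e1 , adj-irr b c e2 , adj-irr c d e3 , trans (eq-sym a d) (adj-irr d a e4)

  closedWalks4≡∑quad : + closedWalks4 vs eq adj ≡ ∑⁴ vs quad
  closedWalks4≡∑quad =
    trans (sum≡∑ vs _) (∑-cong vs (λ a → trans (sum≡∑ vs _) (∑-cong vs (λ b → trans (sum≡∑ vs _) (∑-cong vs (λ c →
      trans (count≡∑ _ vs) (∑-cong vs (λ d → quad-indicator a b c d))))))))

  distinct-common-pairs : ∀ a c →
    ∑ vs (λ b → ∑ vs (λ d → ⟦ not (eq b d) ⟧ * ((A a b * A b c) * (A c d * A d a)))) ≡ common a c * common a c - common a c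
  distinct-common-pairs a c = begin
      ∑ vs (λ b → ∑ vs (λ d → ⟦ not (eq b d) ⟧ * (P b * Q d)))
    ≡⟨ ∑-cong vs (λ b → ∑-cong vs (λ d → trans (cong (_* (P b * Q d)) (⟦not⟧ (eq b d))) (split ⟦ eq b d ⟧ (P b) (Q d)))) ⟩
      ∑ vs (λ b → ∑ vs (λ d → P b * Q d - P b * (⟦ eq b d ⟧ * Q d)))
    ≡⟨ ∑-cong-∈ vs (λ b b∈ → trans (∑-- vs _ _) (cong₂ _-_ (∑-*ˡ vs (P b) Q)
          (trans (∑-*ˡ vs (P b) _) (cong (P b *_) (collapse b b∈ Q Q-resp))))) ⟩
      ∑ vs (λ b → P b * ∑ vs Q - P b * Q b)
    ≡⟨ ∑-cong vs (λ b → cong₂ (λ s t → P b * s - t) (∑-cong vs (λ d → Q≡P d)) (trans (cong (P b *_) (Q≡P b)) (⟦⟧²-idem (adj a b) (adj b c)))) ⟩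
      ∑ vs (λ b → P b * common a c - P b)
    ≡⟨ trans (∑-- vs _ _) (cong (_- common a c) (∑-*ʳ vs (common a c) P)) ⟩
      common a c * common a c - common a c ∎
    where
    open ≡-Reasoning
    P Q : V → ℤ
    P b = A a b * A b c
    Q d = A c d * A d a
    split : ∀ e x y → (1ℤ - e) * (x * y) ≡ x * y - x * (e * y)
    split = solve-∀
    Q≡P : ∀ d → Q d ≡ P d
    Q≡P d = trans (*-comm (A c d) (A d a)) (cong₂ _*_ (A-sym d a) (A-sym c d))
    ⟦⟧²-idem : ∀ p q → (⟦ p ⟧ * ⟦ q ⟧) * (⟦ p ⟧ * ⟦ q ⟧) ≡ ⟦ p ⟧ * ⟦ q ⟧
    ⟦⟧²-idem true true = refl
    ⟦⟧²-idem true false = refl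
    ⟦⟧²-idem false q = refl
    Q-resp : Respects Q
    Q-resp x y e = cong₂ _*_ (cong ⟦_⟧ (adj-respʳ x y c e)) (cong ⟦_⟧ (adj-resp x y a e))

  closedWalks4-formula : + closedWalks4 vs eq adj ≡ ∑ vs (λ a → ∑ vs (λ c → ⟦ not (eq a c) ⟧ * (common a c * common a c - common a c)))
  closedWalks4-formula = begin
      + closedWalks4 vs eq adj
    ≡⟨ closedWalks4≡∑quad ⟩
      ∑⁴ vs quad
    ≡⟨ ∑-cong vs (λ a → ∑-swap vs vs _) ⟩
      ∑ vs (λ a → ∑ vs (λ c → ∑ vs (λ b → ∑ vs (λ d → quad a b c d))))
    ≡⟨ ∑-cong vs (λ a → ∑-cong vs (λ c → trans (∑-cong vs (λ b → ∑-*ˡ vs ⟦ not (eq a c) ⟧ _)) (∑-*ˡ vs ⟦ not (eq a c) ⟧ _))) ⟩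
      ∑ vs (λ a → ∑ vs (λ c → ⟦ not (eq a c) ⟧ * ∑ vs (λ b → ∑ vs (λ d → ⟦ not (eq b d) ⟧ * ((A a b * A b c) * (A c d * A d a))))))
    ≡⟨ ∑-cong vs (λ a → ∑-cong vs (λ c → cong (⟦ not (eq a c) ⟧ *_) (distinct-common-pairs a c))) ⟩
      ∑ vs (λ a → ∑ vs (λ c → ⟦ not (eq a c) ⟧ * (common a c * common a c - common a c))) ∎
    where open ≡-Reasoning

  quad-reflect-bd : ∀ a b c d → quad a d c b ≡ quad a b c d
  quad-reflect-bd a b c d = trans (cong₂ (λ y z → Ne a c * (y * z)) (Ne-sym d b)
        (cong₂ _*_ (cong₂ _*_ (A-sym a d) (A-sym d c)) (cong₂ _*_ (A-sym c b) (A-sym b a))))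
      (reorder (Ne a c) (Ne b d) (A a b) (A b c) (A c d) (A d a))
    where reorder : ∀ x y p q r s → x * (y * ((s * r) * (q * p))) ≡ x * (y * ((p * q) * (r * s)))
          reorder = solve-∀

  quad-reflect-ac : ∀ a b c d → quad c b a d ≡ quad a b c d
  quad-reflect-ac a b c d = trans (cong₂ (λ x z → x * (Ne b d * z)) (Ne-sym c a)
        (cong₂ _*_ (cong₂ _*_ (A-sym c b) (A-sym b a)) (cong₂ _*_ (A-sym a d) (A-sym d c))))
      (reorder (Ne a c) (Ne b d) (A a b) (A b c) (A c d) (A d a))
    where reorder : ∀ x y p q r s → x * (y * ((q * p) * (s * r))) ≡ x * (y * ((p * q) * (r * s)))
          reorder = solve-∀

  quad-reflect-ab-cd : ∀ a b c d → quad b a d c ≡ quad a b c d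
  quad-reflect-ab-cd a b c d = trans (cong (λ z → Ne b d * (Ne a c * z))
        (cong₂ _*_ (cong₂ _*_ (A-sym b a) (A-sym a d)) (cong₂ _*_ (A-sym d c) (A-sym c b))))
      (reorder (Ne a c) (Ne b d) (A a b) (A b c) (A c d) (A d a))
    where reorder : ∀ x y p q r s → y * (x * ((p * s) * (r * q))) ≡ x * (y * ((p * q) * (r * s)))
          reorder = solve-∀

  -- Each quadrangle is traversed by 8 of the counted walks (4 starting points,
  -- 2 directions).  Given a strict total order lt, imposing b < d, then a < c,
  -- then a < b halves the count three times, so the count is divisible by 8.
  module EightFold (lt : V → V → Bool) (lt-total : ∀ a b → eq a b ≡ false → ⟦ lt a b ⟧ + ⟦ lt b a ⟧ ≡ 1ℤ) where

    L : V → V → ℤ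
    L a b = ⟦ lt a b ⟧

    split-distinct : ∀ a b → Ne a b * (L a b + L b a) ≡ Ne a b
    split-distinct a b with eq a b in e
    ... | true = refl
    ... | false = trans (*-identityˡ _) (lt-total a b e)

    split-adjacent : ∀ a b → A a b * (L a b + L b a) ≡ A a b
    split-adjacent a b with adj a b in e
    ... | false = refl
    ... | true = trans (*-identityˡ _) (lt-total a b (adj-irr a b e))

    W₁ W₂ W₃ : ℤ
    W₁ = ∑⁴ vs (λ a b c d → quad a b c d * L b d)
    W₂ = ∑⁴ vs (λ a b c d → quad a b c d * L b d * L a c)
    W₃ = ∑⁴ vs (λ a b c d → quad a b c d * L b d * L a c * L a b)

    halve-bd : ∑⁴ vs quad ≡ W₁ + W₁
    halve-bd = trans (∑⁴-cong vs split) (trans (∑⁴-+ vs _ _) (cong (_+_ W₁)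
        (trans (∑⁴-cong vs (λ a b c d → cong (_* L d b) (sym (quad-reflect-bd a b c d))))
               (∑⁴-swap-bd vs (λ a b c d → quad a b c d * L b d)))))
      where
      reorder : ∀ x y z t → x * (y * z) * t ≡ x * ((y * t) * z)
      reorder = solve-∀
      split : ∀ a b c d → quad a b c d ≡ quad a b c d * L b d + quad a b c d * L d b
      split a b c d = sym (trans (sym (*-distribˡ-+ (quad a b c d) (L b d) (L d b)))
        (trans (reorder (Ne a c) (Ne b d) ((A a b * A b c) * (A c d * A d a)) (L b d + L d b))
          (cong (λ y → Ne a c * (y * ((A a b * A b c) * (A c d * A d a)))) (split-distinct b d))))

    halve-ac : W₁ ≡ W₂ + W₂
    halve-ac = trans (∑⁴-cong vs split) (trans (∑⁴-+ vs _ _) (cong (_+_ W₂)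
        (trans (∑⁴-cong vs (λ a b c d → cong (λ z → z * L b d * L c a) (sym (quad-reflect-ac a b c d))))
               (∑⁴-swap-ac vs (λ a b c d → quad a b c d * L b d * L a c)))))
      where
      reorder : ∀ x y z u t → x * (y * z) * u * t ≡ (x * t) * (y * z) * u
      reorder = solve-∀
      split : ∀ a b c d → quad a b c d * L b d ≡ quad a b c d * L b d * L a c + quad a b c d * L b d * L c a
      split a b c d = sym (trans (sym (*-distribˡ-+ (quad a b c d * L b d) (L a c) (L c a)))
        (trans (reorder (Ne a c) (Ne b d) ((A a b * A b c) * (A c d * A d a)) (L b d) (L a c + L c a))
          (cong (λ x → x * (Ne b d * ((A a b * A b c) * (A c d * A d a))) * L b d) (split-distinct a c))))

    halve-ab : W₂ ≡ W₃ + W₃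
    halve-ab = trans (∑⁴-cong vs split) (trans (∑⁴-+ vs _ _) (cong (_+_ W₃)
        (trans (∑⁴-cong vs (λ a b c d → trans (swap-mid (quad a b c d) (L b d) (L a c) (L b a))
                  (cong (λ z → z * L a c * L b d * L b a) (sym (quad-reflect-ab-cd a b c d)))))
               (∑⁴-swap-ab-cd vs (λ a b c d → quad a b c d * L b d * L a c * L a b)))))
      where
      swap-mid : ∀ r x y z → r * x * y * z ≡ r * y * x * z
      swap-mid = solve-∀
      reorder : ∀ x y p q r u v t → x * (y * ((p * q) * r)) * u * v * t ≡ x * (y * (((p * t) * q) * r)) * u * v
      reorder = solve-∀
      split : ∀ a b c d → quad a b c d * L b d * L a c ≡ quad a b c d * L b d * L a c * L a b + quad a b c d * L b d * L a c * L b a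
      split a b c d = sym (trans (sym (*-distribˡ-+ (quad a b c d * L b d * L a c) (L a b) (L b a)))
        (trans (reorder (Ne a c) (Ne b d) (A a b) (A b c) (A c d * A d a) (L b d) (L a c) (L a b + L b a))
          (cong (λ w → Ne a c * (Ne b d * ((w * A b c) * (A c d * A d a))) * L b d * L a c) (split-adjacent a b))))

    W₃-IsNat : IsNat W₃
    W₃-IsNat = IsNat-∑ vs _ (λ a → IsNat-∑ vs _ (λ b → IsNat-∑ vs _ (λ c → IsNat-∑ vs _ (λ d →
      IsNat-* (IsNat-* (IsNat-* (IsNat-* (IsNat-⟦⟧ (not (eq a c)))
        (IsNat-* (IsNat-⟦⟧ (not (eq b d))) (IsNat-* (IsNat-* (IsNat-⟦⟧ (adj a b)) (IsNat-⟦⟧ (adj b c)))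
                                                     (IsNat-* (IsNat-⟦⟧ (adj c d)) (IsNat-⟦⟧ (adj d a))))))
        (IsNat-⟦⟧ (lt b d))) (IsNat-⟦⟧ (lt a c))) (IsNat-⟦⟧ (lt a b))))))

    closedWalks4≡8W₃ : + closedWalks4 vs eq adj ≡ + 8 * W₃
    closedWalks4≡8W₃ = trans closedWalks4≡∑quad (trans halve-bd (trans (cong₂ _+_ halve-ac halve-ac)
      (trans (cong₂ (λ u v → (u + u) + (v + v)) halve-ab halve-ab) (eight W₃))))
      where eight : ∀ w → (w + w + (w + w)) + (w + w + (w + w)) ≡ + 8 * w
            eight = solve-∀

    eight-n₄ : + 8 * + (closedWalks4 vs eq adj ℕ./ 8) ≡ + closedWalks4 vs eq adj
    eight-n₄ with W₃-IsNat
    ... | K , W₃≡K = begin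
        + 8 * + (closedWalks4 vs eq adj ℕ./ 8)   ≡⟨ cong (λ z → + 8 * + (z ℕ./ 8)) cw≡8K ⟩
        + 8 * + ((8 ℕ.* K) ℕ./ 8)                ≡⟨ cong (λ z → + 8 * + (z ℕ./ 8)) (ℕP.*-comm 8 K) ⟩
        + 8 * + ((K ℕ.* 8) ℕ./ 8)                ≡⟨ cong (λ z → + 8 * + z) (m*n/n≡m K 8) ⟩
        + 8 * + K                                 ≡⟨ sym (pos-* 8 K) ⟩
        + (8 ℕ.* K)                               ≡⟨ cong +_ (sym cw≡8K) ⟩
        + closedWalks4 vs eq adj                  ∎
      where
      open ≡-Reasoning
      cw≡8K : closedWalks4 vs eq adj ≡ 8 ℕ.* K
      cw≡8K = +-injective (trans closedWalks4≡8W₃ (trans (cong (+ 8 *_) W₃≡K) (sym (pos-* 8 K))))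

conflict : ∀ {b : Bool} → b ≡ false → b ≡ true → ⊥
conflict refl ()

-- Edge lists: edgesOf vs adj lists each edge {x,y} once, as (x , y) with x
-- before y in vs.  We need that no edge occurs also in reversed orientation,
-- which holds when vs has no repetitions up to eq.
module EdgeList {V : Set} (eq adj : V → V → Bool) (eq-sym : ∀ a b → eq a b ≡ eq b a) where

  ∈-block : ∀ {p} z zs → p ∈ map (λ y → (z , y)) (filterᵇ (adj z) zs) →
    proj₁ p ≡ z × proj₂ p ∈ zs × adj z (proj₂ p) ≡ true
  ∈-block z (w ∷ ws) p∈ with adj z w in e
  ∈-block z (w ∷ ws) (here refl) | true = refl , here refl , e
  ∈-block z (w ∷ ws) (there p∈) | true with ∈-block z ws p∈
  ... | p₁≡z , p₂∈ , adj-p = p₁≡z , there p₂∈ , adj-p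
  ∈-block z (w ∷ ws) p∈ | false with ∈-block z ws p∈
  ... | p₁≡z , p₂∈ , adj-p = p₁≡z , there p₂∈ , adj-p

  ∈-edgesOf : ∀ {p} zs → p ∈ edgesOf zs adj → proj₁ p ∈ zs × proj₂ p ∈ zs × adj (proj₁ p) (proj₂ p) ≡ true
  ∈-edgesOf (z ∷ zs) p∈ with ∈-++⁻ (map (λ y → (z , y)) (filterᵇ (adj z) zs)) p∈
  ... | inj₁ p∈block with ∈-block z zs p∈block
  ...   | refl , p₂∈ , adj-p = here refl , there p₂∈ , adj-p
  ∈-edgesOf (z ∷ zs) p∈ | inj₂ p∈rest with ∈-edgesOf zs p∈rest
  ...   | p₁∈ , p₂∈ , adj-p = there p₁∈ , there p₂∈ , adj-p

  data Distinct : List V → Set where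
    [] : Distinct []
    _∷_ : ∀ {x xs} → (∀ y → y ∈ xs → eq x y ≡ false) → Distinct xs → Distinct (x ∷ xs)

  no-reversed-edge : ∀ {zs x y x' y'} → Distinct zs → (x , y) ∈ edgesOf zs adj → (x' , y') ∈ edgesOf zs adj →
    eq x y' ≡ true → eq y x' ≡ true → ⊥
  no-reversed-edge {z ∷ zs} (fresh ∷ dist) e∈ e'∈ xy' yx'
    with ∈-++⁻ (map (λ y → (z , y)) (filterᵇ (adj z) zs)) e∈ | ∈-++⁻ (map (λ y → (z , y)) (filterᵇ (adj z) zs)) e'∈
  ... | inj₁ e∈block | inj₁ e'∈block with ∈-block z zs e∈block | ∈-block z zs e'∈block
  ...   | refl , _ , _ | _ , y'∈ , _ = conflict (fresh _ y'∈) xy'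
  no-reversed-edge {z ∷ zs} (fresh ∷ dist) e∈ e'∈ xy' yx' | inj₁ e∈block | inj₂ e'∈rest
    with ∈-block z zs e∈block | ∈-edgesOf zs e'∈rest
  ...   | refl , _ , _ | _ , y'∈ , _ = conflict (fresh _ y'∈) xy'
  no-reversed-edge {z ∷ zs} (fresh ∷ dist) e∈ e'∈ xy' yx' | inj₂ e∈rest | inj₁ e'∈block
    with ∈-edgesOf zs e∈rest | ∈-block z zs e'∈block
  ...   | _ , y∈ , _ | refl , _ , _ = conflict (fresh _ y∈) (trans (eq-sym _ _) yx')
  no-reversed-edge {z ∷ zs} (fresh ∷ dist) e∈ e'∈ xy' yx' | inj₂ e∈rest | inj₂ e'∈rest =
    no-reversed-edge dist e∈rest e'∈rest xy' yx'

  module _ (eq-refl : ∀ a → eq a a ≡ true) where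

    hit⇒count≥1 : ∀ {p : V → Bool} {y} xs → y ∈ xs → p y ≡ true → 1 ℕ.≤ length (filterᵇ p xs)
    hit⇒count≥1 {p} (x ∷ xs) (here refl) e rewrite e = ℕ.s≤s ℕ.z≤n
    hit⇒count≥1 {p} (x ∷ xs) (there y∈) e with p x
    ... | true = ℕ.s≤s ℕ.z≤n
    ... | false = hit⇒count≥1 xs y∈ e

    count-tail : ∀ (p : V → Bool) x xs → length (filterᵇ p xs) ℕ.≤ length (filterᵇ p (x ∷ xs))
    count-tail p x xs with p x
    ... | true = ℕP.n≤1+n _
    ... | false = ℕP.≤-refl

    distinct-from-count : ∀ xs → (∀ a → length (filterᵇ (eq a) xs) ℕ.≤ 1) → Distinct xs
    distinct-from-count [] h = []
    distinct-from-count (x ∷ xs) h = fresh ∷ distinct-from-count xs (λ a → ℕP.≤-trans (count-tail (eq a) x xs) (h a))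
      where
      fresh : ∀ y → y ∈ xs → eq x y ≡ false
      fresh y y∈ with eq x y in e
      ... | false = refl
      ... | true = ⊥-elim (two≰one (ℕP.≤-trans (ℕ.s≤s (hit⇒count≥1 {eq x} xs y∈ e)) (subst (ℕ._≤ 1) count-x (h x))))
        where
        count-x : length (filterᵇ (eq x) (x ∷ xs)) ≡ suc (length (filterᵇ (eq x) xs))
        count-x rewrite eq-refl x = refl
        two≰one : ¬ (2 ℕ.≤ 1)
        two≰one (ℕ.s≤s ())

-- The final step of the line-graph count (closedWalks4-line): 4·X is given
-- in terms of four sums dd, cd, c, d, whose values in N, k, T₃, T₄ are known.
line-count-algebra : ∀ X N k T₃ T₄ dd cd c d →
  dd ≡ + 4 * (N * (k * (k * k)) + k * T₃ + k * T₃ + T₄) → cd ≡ + 4 * (0ℤ + N * (k * k) + N * (k * k) + T₃) →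
  c ≡ + 4 * (N * (k * k)) → d ≡ + 4 * (N * (k * (k * k))) →
  + 4 * X ≡ dd + + 2 * (k - + 4) * cd + (k - + 4) * (k - + 4) * c - d - (k - + 4) * c + (N * k) * (+ 4 * (k - + 4) * (k - + 4))
            - (N * k) * (+ 2 * ((+ 2 + (k - + 4) * + 2) * (+ 2 + (k - + 4) * + 2) - (+ 2 + (k - + 4) * + 2))) →
  X ≡ T₄ + + 4 * (k - + 2) * T₃ + N * k * (k * (k - + 3) * (k - + 3) - + 5)
line-count-algebra X N k T₃ T₄ _ _ _ _ refl refl refl refl h = *-cancelˡ-≡ (+ 4) X _ (trans h (normalise N k T₃ T₄))
  where
  normalise : ∀ N k T₃ T₄ →
    + 4 * (N * (k * (k * k)) + k * T₃ + k * T₃ + T₄) + + 2 * (k - + 4) * (+ 4 * (0ℤ + N * (k * k) + N * (k * k) + T₃))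
      + (k - + 4) * (k - + 4) * (+ 4 * (N * (k * k))) - + 4 * (N * (k * (k * k))) - (k - + 4) * (+ 4 * (N * (k * k)))
      + (N * k) * (+ 4 * (k - + 4) * (k - + 4))
      - (N * k) * (+ 2 * ((+ 2 + (k - + 4) * + 2) * (+ 2 + (k - + 4) * + 2) - (+ 2 + (k - + 4) * + 2)))
    ≡ + 4 * (T₄ + + 4 * (k - + 2) * T₃ + N * k * (k * (k - + 3) * (k - + 3) - + 5))
  normalise = solve-∀

module RegularGraph {V : Set} (vs : List V) (eq adj : V → V → Bool)
  (eq-refl : ∀ a → eq a a ≡ true)
  (eq-sym : ∀ a b → eq a b ≡ eq b a)
  (eq-trans : ∀ a b c → eq a b ≡ true → eq b c ≡ true → eq a c ≡ true)
  (delta : ∀ a → ∑ vs (λ y → ⟦ eq a y ⟧) ≡ 1ℤ)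
  (adj-sym : ∀ a b → adj a b ≡ adj b a)
  (adj-irr : ∀ a b → adj a b ≡ true → eq a b ≡ false)
  (adj-resp : ∀ a b c → eq a b ≡ true → adj a c ≡ adj b c)
  (k : ℤ) (regular : ∀ a → ∑ vs (λ b → ⟦ adj a b ⟧) ≡ k)
  where

  open ClosedWalks vs eq adj eq-sym (λ a _ → delta a) adj-sym adj-irr adj-resp public
  open EdgeList eq adj eq-sym

  eval-at : ∀ a → (f : V → ℤ) → Respects f → ∑ vs (λ y → ⟦ eq a y ⟧ * f y) ≡ f a
  eval-at a = collapse-at a (delta a)

  A-irr : ∀ a → A a a ≡ 0ℤ
  A-irr a with adj a a in e
  ... | false = refl
  ... | true = ⊥-elim (conflict (adj-irr a a e) (eq-refl a))

  eq-resp : ∀ a b c → eq a b ≡ true → eq a c ≡ eq b c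
  eq-resp a b c e with eq b c in e₂
  ... | true = eq-trans a b c e e₂
  ... | false with eq a c in e₃
  ...   | false = refl
  ...   | true = ⊥-elim (conflict e₂ (eq-trans b a c (trans (eq-sym b a) e) e₃))

  eq-respʳ : ∀ a b c → eq a b ≡ true → eq c a ≡ eq c b
  eq-respʳ a b c e = trans (eq-sym c a) (trans (eq-resp a b c e) (eq-sym b c))

  A-resp : ∀ q → Respects (λ a → A a q)
  A-resp q a b e = cong ⟦_⟧ (adj-resp a b q e)

  A-respʳ : ∀ q → Respects (λ b → A q b)
  A-respʳ q a b e = cong ⟦_⟧ (adj-respʳ a b q e)

  δ-respʳ : ∀ q → Respects (λ a → ⟦ eq q a ⟧)
  δ-respʳ q a b e = cong ⟦_⟧ (eq-respʳ a b q e)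

  *-resp : ∀ {f g} → Respects f → Respects g → Respects (λ a → f a * g a)
  *-resp rf rg a b e = cong₂ _*_ (rf a b e) (rg a b e)

  ∑-resp : ∀ {f : V → V → ℤ} → (∀ y → Respects (λ a → f a y)) → Respects (λ a → ∑ vs (f a))
  ∑-resp rf a b e = ∑-cong vs (λ y → rf y a b e)

  eval-at² : ∀ p q (f : V → V → ℤ) → (∀ b → Respects (λ a → f a b)) → (∀ a → Respects (f a)) →
    ∑ vs (λ a → ∑ vs (λ b → ⟦ eq p a ⟧ * (⟦ eq q b ⟧ * f a b))) ≡ f p q
  eval-at² p q f r₁ r₂ = trans (∑-cong vs (λ a → trans (∑-*ˡ vs ⟦ eq p a ⟧ (λ b → ⟦ eq q b ⟧ * f a b))
      (cong (⟦ eq p a ⟧ *_) (eval-at q (f a) (r₂ a))))) (eval-at p (λ a → f a q) (r₁ q))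

  N : ℤ
  N = ∑ vs (λ _ → 1ℤ)

  ∑-const : ∀ c → ∑ vs (λ _ → c) ≡ N * c
  ∑-const c = trans (∑-cong vs (λ _ → sym (*-identityˡ c))) (∑-*ʳ vs c (λ _ → 1ℤ))

  regular-* : ∀ x c → ∑ vs (λ y → A x y * c) ≡ k * c
  regular-* x c = trans (∑-*ʳ vs c (A x)) (cong (_* c) (regular x))

  regularˡ : ∀ w → ∑ vs (λ v → A v w) ≡ k
  regularˡ w = trans (∑-cong vs (λ v → A-sym v w)) (regular w)

  A-idem : ∀ a b → A a b * A a b ≡ A a b
  A-idem a b = ⟦⟧-idem (adj a b)

  T₃ T₄ : ℤ
  T₃ = ∑ vs (λ a → ∑ vs (λ b → ∑ vs (λ c → A a b * (A b c * A c a))))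
  T₄ = ∑ vs (λ a → ∑ vs (λ c → common a c * common a c))

  common-resp : ∀ a → Respects (common a)
  common-resp a c c' e = ∑-cong vs (λ b → cong (A a b *_) (A-respʳ b c c' e))

  closedWalks4-regular : + closedWalks4 vs eq adj ≡ T₄ - N * (k * k) - N * (k * k - k)
  closedWalks4-regular =
    trans closedWalks4-formula (trans (∑-off-diagonal (λ a c → common a c * common a c - common a c) excess-resp)
      (cong₂ _-_ (trans (∑-cong vs (λ a → ∑-- vs _ _)) (trans (∑-- vs _ _) (cong (_-_ T₄) ∑common))) diagonal))
    where
    excess-resp : ∀ a → Respects (λ c → common a c * common a c - common a c)
    excess-resp a c c' e = cong₂ (λ u v → u * u - v) (common-resp a c c' e) (common-resp a c c' e)
    ∑common : ∑ vs (λ a → ∑ vs (common a)) ≡ N * (k * k)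
    ∑common = trans (∑-cong vs (λ a → trans (∑-swap vs vs (λ c b → A a b * A b c))
        (trans (∑-cong vs (λ b → trans (∑-*ˡ vs (A a b) (A b)) (cong (A a b *_) (regular b))))
               (trans (∑-*ʳ vs k (A a)) (cong (_* k) (regular a))))))
      (∑-const (k * k))
    common-diag : ∀ a → common a a ≡ k
    common-diag a = trans (∑-cong vs (λ b → trans (cong (A a b *_) (A-sym b a)) (A-idem a b))) (regular a)
    diagonal : ∑ vs (λ a → common a a * common a a - common a a) ≡ N * (k * k - k)
    diagonal = trans (∑-cong vs (λ a → cong (λ z → z * z - z) (common-diag a))) (∑-const _)

  -- sums over the edge list: each unordered edge is one ordered pair of adjacent vertices out of two
  ∑-edges : ∀ xs (F : V × V → ℤ) → (∀ x y → F (x , y) ≡ F (y , x)) →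
    + 2 * ∑ (edgesOf xs adj) F ≡ ∑ xs (λ x → ∑ xs (λ y → A x y * F (x , y)))
  ∑-edges [] F sym-F = refl
  ∑-edges (z ∷ zs) F sym-F = begin
      + 2 * ∑ (edgesOf (z ∷ zs) adj) F
    ≡⟨ cong (+ 2 *_) (trans (∑-++ (map (z ,_) (filterᵇ (adj z) zs)) (edgesOf zs adj) F)
         (cong (_+ ∑ (edgesOf zs adj) F) (trans (∑-map (z ,_) (filterᵇ (adj z) zs) F) (∑-filter (adj z) zs (λ y → F (z , y)))))) ⟩
      + 2 * (row + ∑ (edgesOf zs adj) F)
    ≡⟨ trans (*-distribˡ-+ (+ 2) row _) (cong (_+_ (+ 2 * row)) (∑-edges zs F sym-F)) ⟩
      + 2 * row + rest
    ≡⟨ spread row rest (A z z * F (z , z)) (trans (cong (_* F (z , z)) (A-irr z)) (*-zeroˡ (F (z , z)))) ⟩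
      (A z z * F (z , z) + row) + (row + rest)
    ≡⟨ cong (λ u → (A z z * F (z , z) + row) + (u + rest)) column ⟩
      (A z z * F (z , z) + row) + (∑ zs (λ x → A x z * F (x , z)) + rest)
    ≡⟨ cong (_+_ (A z z * F (z , z) + row)) (sym (∑-+ zs (λ x → A x z * F (x , z)) (λ x → ∑ zs (λ y → A x y * F (x , y))))) ⟩
      ∑ (z ∷ zs) (λ x → ∑ (z ∷ zs) (λ y → A x y * F (x , y))) ∎
    where
    open ≡-Reasoning
    row rest : ℤ
    row = ∑ zs (λ y → A z y * F (z , y))
    rest = ∑ zs (λ x → ∑ zs (λ y → A x y * F (x , y)))
    column : row ≡ ∑ zs (λ x → A x z * F (x , z))
    column = ∑-cong zs (λ y → cong₂ _*_ (A-sym z y) (sym-F z y))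
    spread : ∀ t u w → w ≡ 0ℤ → + 2 * t + u ≡ (w + t) + (t + u)
    spread t u w refl = norm t u
      where norm : ∀ t u → + 2 * t + u ≡ (0ℤ + t) + (t + u)
            norm = solve-∀

  vs-distinct : Distinct vs
  vs-distinct = distinct-from-count eq-refl vs at-most-one
    where
    at-most-one : ∀ a → length (filterᵇ (eq a) vs) ℕ.≤ 1
    at-most-one a rewrite +-injective (trans (count≡∑ (eq a) vs) (delta a)) = ℕP.≤-refl

  es : List (V × V)
  es = edgesOf vs adj

  δ : V × V → V × V → ℤ
  δ e f = ⟦ eqEdge eq e f ⟧

  swap : V × V → V × V
  swap (a , b) = (b , a)

  edge-delta : ∀ e → e ∈ es → ∑ es (δ e) ≡ 1ℤ
  edge-delta (x , y) xy∈ = *-cancelˡ-≡ (+ 2) _ _ (trans twice (sym (*-identityʳ (+ 2))))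
    where
    G : V × V → ℤ
    G f = δ (x , y) f + δ (x , y) (swap f)
    reversed-absent : ∑ es (λ f → δ (x , y) (swap f)) ≡ 0ℤ
    reversed-absent = trans (∑-cong-∈ es absent) (∑-0 es)
      where
      absent : ∀ f → f ∈ es → δ (x , y) (swap f) ≡ 0ℤ
      absent (a , b) f∈ with eq x b in e₁ | eq y a in e₂
      ... | false | _ = refl
      ... | true | false = refl
      ... | true | true = ⊥-elim (no-reversed-edge vs-distinct xy∈ f∈ e₁ e₂)
    Axy : A x y ≡ 1ℤ
    Axy = cong ⟦_⟧ (proj₂ (proj₂ (∈-edgesOf vs xy∈)))
    twice : + 2 * ∑ es (δ (x , y)) ≡ + 2
    twice = begin
        + 2 * ∑ es (δ (x , y))
      ≡⟨ cong (+ 2 *_) (sym (trans (∑-+ es (δ (x , y)) (λ f → δ (x , y) (swap f)))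
           (trans (cong (_+_ (∑ es (δ (x , y)))) reversed-absent) (+-identityʳ _)))) ⟩
        + 2 * ∑ es G
      ≡⟨ ∑-edges vs G (λ a b → +-comm (δ (x , y) (a , b)) _) ⟩
        ∑ vs (λ a → ∑ vs (λ b → A a b * G (a , b)))
      ≡⟨ ∑-cong vs (λ a → trans (∑-cong vs (λ b → trans (cong (A a b *_) (cong₂ _+_ (⟦∧⟧ (eq x a) (eq y b)) (⟦∧⟧ (eq x b) (eq y a))))
           (expand (A a b) ⟦ eq x a ⟧ ⟦ eq y b ⟧ ⟦ eq x b ⟧ ⟦ eq y a ⟧))) (∑-+ vs _ _)) ⟩
        ∑ vs (λ a → ∑ vs (λ b → ⟦ eq x a ⟧ * (⟦ eq y b ⟧ * A a b)) + ∑ vs (λ b → ⟦ eq y a ⟧ * (⟦ eq x b ⟧ * A a b)))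
      ≡⟨ trans (∑-+ vs _ _) (cong₂ _+_ (eval-at² x y A A-resp A-respʳ) (eval-at² y x A A-resp A-respʳ)) ⟩
        A x y + A y x
      ≡⟨ cong₂ _+_ Axy (trans (A-sym y x) Axy) ⟩
        + 2 ∎
      where
      open ≡-Reasoning
      expand : ∀ w p q r s → w * (p * q + r * s) ≡ p * (q * w) + s * (r * w)
      expand = solve-∀

  eqE : V × V → V × V → Bool
  eqE = eqEdge eq

  eqE-sym : ∀ e f → eqE e f ≡ eqE f e
  eqE-sym (x , y) (x' , y') = cong₂ _∧_ (eq-sym x x') (eq-sym y y')

  ∧-split : ∀ {a b} → a ∧ b ≡ true → a ≡ true × b ≡ true
  ∧-split {true} {true} refl = refl , refl

  adjLine-sym : ∀ e f → adjLine eq e f ≡ adjLine eq f e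
  adjLine-sym (x , y) (x' , y') rewrite eq-sym x' x | eq-sym y' y | eq-sym x' y | eq-sym y' x =
    cong (λ z → not (eq x x' ∧ eq y y') ∧ z) (∨-middle (eq x x') (eq x y') (eq y x') (eq y y'))
    where
    ∨-middle : ∀ a b c d → a ∨ b ∨ c ∨ d ≡ a ∨ c ∨ b ∨ d
    ∨-middle true b c d = refl
    ∨-middle false true true d = refl
    ∨-middle false true false d = refl
    ∨-middle false false true d = refl
    ∨-middle false false false d = refl

  adjLine-irr : ∀ e f → adjLine eq e f ≡ true → eqE e f ≡ false
  adjLine-irr (x , y) (x' , y') h with eq x x' ∧ eq y y'
  adjLine-irr (x , y) (x' , y') () | true
  ... | false = refl

  adjLine-resp : ∀ e f g → eqE e f ≡ true → adjLine eq e g ≡ adjLine eq f g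
  adjLine-resp (x , y) (x₂ , y₂) (x' , y') h with ∧-split {eq x x₂} h
  ... | h₁ , h₂ rewrite eq-resp x x₂ x' h₁ | eq-resp x x₂ y' h₁ | eq-resp y y₂ x' h₂ | eq-resp y y₂ y' h₂ = refl

  module LG = ClosedWalks es eqE (adjLine eq) eqE-sym edge-delta adjLine-sym adjLine-irr adjLine-resp

  C D : V × V → V × V → ℤ
  C (x , y) (x' , y') = ⟦ eq x x' ⟧ + ⟦ eq x y' ⟧ + ⟦ eq y x' ⟧ + ⟦ eq y y' ⟧
  D (x , y) (x' , y') = A x x' + A x y' + A y x' + A y y'

  C-swapʳ : ∀ e a b → C e (a , b) ≡ C e (b , a)
  C-swapʳ (x , y) a b = shuffle ⟦ eq x a ⟧ ⟦ eq x b ⟧ ⟦ eq y a ⟧ ⟦ eq y b ⟧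
    where shuffle : ∀ p q r s → p + q + r + s ≡ q + p + s + r
          shuffle = solve-∀

  C-swapˡ : ∀ g a b → C (a , b) g ≡ C (b , a) g
  C-swapˡ (x , y) a b = shuffle ⟦ eq a x ⟧ ⟦ eq a y ⟧ ⟦ eq b x ⟧ ⟦ eq b y ⟧
    where shuffle : ∀ p q r s → p + q + r + s ≡ r + s + p + q
          shuffle = solve-∀

  D-swapʳ : ∀ e a b → D e (a , b) ≡ D e (b , a)
  D-swapʳ (x , y) a b = shuffle (A x a) (A x b) (A y a) (A y b)
    where shuffle : ∀ p q r s → p + q + r + s ≡ q + p + s + r
          shuffle = solve-∀

  D-swapˡ : ∀ g a b → D (a , b) g ≡ D (b , a) g
  D-swapˡ (x , y) a b = shuffle (A a x) (A a y) (A b x) (A b y)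
    where shuffle : ∀ p q r s → p + q + r + s ≡ r + s + p + q
          shuffle = solve-∀

  C-respˡ : ∀ g → LG.Respects (λ h → C h g)
  C-respˡ (x' , y') (x , y) (x₂ , y₂) h with ∧-split {eq x x₂} h
  ... | h₁ , h₂ rewrite eq-resp x x₂ x' h₁ | eq-resp x x₂ y' h₁ | eq-resp y y₂ x' h₂ | eq-resp y y₂ y' h₂ = refl

  C-respʳ : ∀ e → LG.Respects (λ h → C e h)
  C-respʳ (x , y) (x' , y') (x₂ , y₂) h with ∧-split {eq x' x₂} h
  ... | h₁ , h₂ rewrite eq-respʳ x' x₂ x h₁ | eq-respʳ y' y₂ x h₂ | eq-respʳ x' x₂ y h₁ | eq-respʳ y' y₂ y h₂ = refl

  D-respʳ : ∀ e → LG.Respects (λ h → D e h)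
  D-respʳ (x , y) (x' , y') (x₂ , y₂) h with ∧-split {eq x' x₂} h
  ... | h₁ , h₂ rewrite adj-respʳ x' x₂ x h₁ | adj-respʳ y' y₂ x h₂ | adj-respʳ x' x₂ y h₁ | adj-respʳ y' y₂ y h₂ = refl

  δ-respˡ : ∀ g → LG.Respects (λ h → δ h g)
  δ-respˡ (x' , y') (x , y) (x₂ , y₂) h with ∧-split {eq x x₂} h
  ... | h₁ , h₂ rewrite eq-resp x x₂ x' h₁ | eq-resp y y₂ y' h₂ = refl

  AL : V × V → V × V → ℤ
  AL e f = ⟦ adjLine eq e f ⟧

  eq-flip : ∀ {a b} → eq a b ≡ true → eq b a ≡ true
  eq-flip {a} {b} e = trans (eq-sym b a) e

  -- two listed edges share C(e,f) end-vertices: none or one if distinct, two if equal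
  line-adjacency : ∀ e f → e ∈ es → f ∈ es → AL e f + + 2 * δ e f ≡ C e f
  line-adjacency (x , y) (x' , y') e∈ f∈
    with adj-irr x y (proj₂ (proj₂ (∈-edgesOf vs e∈))) | adj-irr x' y' (proj₂ (proj₂ (∈-edgesOf vs f∈)))
  ... | x≉y | x'≉y' with eq x x' in e₁ | eq y y' in e₂ | eq x y' in e₃ | eq y x' in e₄
  ... | true  | true  | true  | _     = ⊥-elim (conflict x'≉y' (eq-trans x' x y' (eq-flip e₁) e₃))
  ... | true  | true  | false | true  = ⊥-elim (conflict x'≉y' (eq-trans x' y y' (eq-flip e₄) e₂))
  ... | true  | true  | false | false = refl
  ... | true  | false | true  | _     = ⊥-elim (conflict x'≉y' (eq-trans x' x y' (eq-flip e₁) e₃))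
  ... | true  | false | false | true  = ⊥-elim (conflict x≉y (eq-trans x x' y e₁ (eq-flip e₄)))
  ... | true  | false | false | false = refl
  ... | false | true  | true  | _     = ⊥-elim (conflict x≉y (eq-trans x y' y e₃ (eq-flip e₂)))
  ... | false | true  | false | true  = ⊥-elim (conflict x'≉y' (eq-trans x' y y' (eq-flip e₄) e₂))
  ... | false | true  | false | false = refl
  ... | false | false | true  | true  = ⊥-elim (no-reversed-edge vs-distinct e∈ f∈ e₃ e₄)
  ... | false | false | true  | false = refl
  ... | false | false | false | true  = refl
  ... | false | false | false | false = refl

  AL≡C-2δ : ∀ e f → e ∈ es → f ∈ es → AL e f ≡ C e f - + 2 * δ e f
  AL≡C-2δ e f e∈ f∈ = sym (trans (cong (_- + 2 * δ e f) (sym (line-adjacency e f e∈ f∈))) (cancel (AL e f) (+ 2 * δ e f)))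
    where cancel : ∀ a b → a + b - b ≡ a
          cancel = solve-∀

  β : V → V → V → ℤ
  β p v w = ⟦ eq p v ⟧ + ⟦ eq p w ⟧

  ∑² : (V → V → ℤ) → ℤ
  ∑² f = ∑ vs (λ v → ∑ vs (λ w → f v w))

  ∑²-cong : ∀ {f g} → (∀ v w → f v w ≡ g v w) → ∑² f ≡ ∑² g
  ∑²-cong e = ∑-cong vs (λ v → ∑-cong vs (λ w → e v w))

  ∑²-+ : ∀ f g → ∑² (λ v w → f v w + g v w) ≡ ∑² f + ∑² g
  ∑²-+ f g = trans (∑-cong vs (λ v → ∑-+ vs (f v) (g v))) (∑-+ vs _ _)

  ∑²-+⁴ : ∀ f g h i → ∑² (λ v w → f v w + g v w + h v w + i v w) ≡ ∑² f + ∑² g + ∑² h + ∑² i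
  ∑²-+⁴ f g h i = trans (∑²-+ (λ v w → f v w + g v w + h v w) i)
    (cong (_+ ∑² i) (trans (∑²-+ (λ v w → f v w + g v w) h) (cong (_+ ∑² h) (∑²-+ f g))))

  incident-pairs : ∀ p q → ∑² (λ v w → A v w * (β p v w * β q v w)) ≡ + 2 * k * ⟦ eq p q ⟧ + + 2 * A p q
  incident-pairs p q = begin
      ∑² (λ v w → A v w * (β p v w * β q v w))
    ≡⟨ trans (∑²-cong (λ v w → expand (A v w) ⟦ eq p v ⟧ ⟦ eq p w ⟧ ⟦ eq q v ⟧ ⟦ eq q w ⟧)) (∑²-+⁴ _ _ _ _) ⟩
      ∑² (λ v w → ⟦ eq p v ⟧ * (⟦ eq q v ⟧ * A v w)) + ∑² (λ v w → ⟦ eq p v ⟧ * (⟦ eq q w ⟧ * A v w))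
        + ∑² (λ v w → ⟦ eq q v ⟧ * (⟦ eq p w ⟧ * A v w)) + ∑² (λ v w → ⟦ eq p w ⟧ * (⟦ eq q w ⟧ * A v w))
    ≡⟨ cong₂ _+_ (cong₂ _+_ (cong₂ _+_ both-tail (eval-at² p q A A-resp A-respʳ))
                            (trans (eval-at² q p A A-resp A-respʳ) (A-sym q p))) both-head ⟩
      ⟦ eq p q ⟧ * k + A p q + A p q + ⟦ eq p q ⟧ * k
    ≡⟨ collect ⟦ eq p q ⟧ k (A p q) ⟩
      + 2 * k * ⟦ eq p q ⟧ + + 2 * A p q ∎
    where
    open ≡-Reasoning
    expand : ∀ a b c d e → a * ((b + c) * (d + e)) ≡ b * (d * a) + b * (e * a) + d * (c * a) + c * (e * a)
    expand = solve-∀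
    collect : ∀ i k a → i * k + a + a + i * k ≡ + 2 * k * i + + 2 * a
    collect = solve-∀
    endpoint : ∑ vs (λ v → ⟦ eq p v ⟧ * (⟦ eq q v ⟧ * k)) ≡ ⟦ eq p q ⟧ * k
    endpoint = trans (eval-at p (λ v → ⟦ eq q v ⟧ * k) (*-resp (δ-respʳ q) (λ _ _ _ → refl))) (cong (λ z → ⟦ z ⟧ * k) (eq-sym q p))
    both-tail : ∑² (λ v w → ⟦ eq p v ⟧ * (⟦ eq q v ⟧ * A v w)) ≡ ⟦ eq p q ⟧ * k
    both-tail = trans (∑-cong vs (λ v → trans (∑-*ˡ vs ⟦ eq p v ⟧ (λ w → ⟦ eq q v ⟧ * A v w))
        (cong (⟦ eq p v ⟧ *_) (trans (∑-*ˡ vs ⟦ eq q v ⟧ (A v)) (cong (⟦ eq q v ⟧ *_) (regular v)))))) endpoint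
    both-head : ∑² (λ v w → ⟦ eq p w ⟧ * (⟦ eq q w ⟧ * A v w)) ≡ ⟦ eq p q ⟧ * k
    both-head = trans (∑-swap vs vs (λ v w → ⟦ eq p w ⟧ * (⟦ eq q w ⟧ * A v w)))
      (trans (∑-cong vs (λ w → trans (∑-*ˡ vs ⟦ eq p w ⟧ (λ v → ⟦ eq q w ⟧ * A v w))
          (cong (⟦ eq p w ⟧ *_) (trans (∑-*ˡ vs ⟦ eq q w ⟧ (λ v → A v w)) (cong (⟦ eq q w ⟧ *_) (regularˡ w)))))) endpoint)

  incidence-walks : ∀ e g → ∑ es (λ h → C e h * C h g) ≡ k * C e g + D e g
  incidence-walks (x , y) (x' , y') = *-cancelˡ-≡ (+ 2) _ _ (trans doubled (sym (*-distribˡ-+ (+ 2) (k * C e g) (D e g))))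
    where
    e g : V × V
    e = (x , y)
    g = (x' , y')
    swap-sym : ∀ v w → C e (v , w) * C (v , w) g ≡ C e (w , v) * C (w , v) g
    swap-sym v w = cong₂ _*_ (C-swapʳ e v w) (C-swapˡ g v w)
    as-β : ∀ v w → A v w * (C e (v , w) * C (v , w) g) ≡
      A v w * (β x v w * β x' v w) + A v w * (β x v w * β y' v w) + A v w * (β y v w * β x' v w) + A v w * (β y v w * β y' v w)
    as-β v w rewrite eq-sym v x' | eq-sym v y' | eq-sym w x' | eq-sym w y' =
      expand (A v w) ⟦ eq x v ⟧ ⟦ eq x w ⟧ ⟦ eq y v ⟧ ⟦ eq y w ⟧ ⟦ eq x' v ⟧ ⟦ eq y' v ⟧ ⟦ eq x' w ⟧ ⟦ eq y' w ⟧
      where expand : ∀ a p₁ p₂ p₃ p₄ q₁ q₂ q₃ q₄ → a * ((p₁ + p₂ + p₃ + p₄) * (q₁ + q₂ + q₃ + q₄)) ≡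
                       a * ((p₁ + p₂) * (q₁ + q₃)) + a * ((p₁ + p₂) * (q₂ + q₄)) + a * ((p₃ + p₄) * (q₁ + q₃)) + a * ((p₃ + p₄) * (q₂ + q₄))
            expand = solve-∀
    collect : ∀ k a b c d p q r s → (+ 2 * k * a + + 2 * p) + (+ 2 * k * b + + 2 * q) + (+ 2 * k * c + + 2 * r) + (+ 2 * k * d + + 2 * s)
              ≡ + 2 * (k * (a + b + c + d)) + + 2 * (p + q + r + s)
    collect = solve-∀
    doubled : + 2 * ∑ es (λ h → C e h * C h g) ≡ + 2 * (k * C e g) + + 2 * D e g
    doubled = begin
        + 2 * ∑ es (λ h → C e h * C h g)
      ≡⟨ ∑-edges vs (λ h → C e h * C h g) swap-sym ⟩
        ∑² (λ v w → A v w * (C e (v , w) * C (v , w) g))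
      ≡⟨ trans (∑²-cong as-β) (∑²-+⁴ _ _ _ _) ⟩
        ∑² (λ v w → A v w * (β x v w * β x' v w)) + ∑² (λ v w → A v w * (β x v w * β y' v w))
          + ∑² (λ v w → A v w * (β y v w * β x' v w)) + ∑² (λ v w → A v w * (β y v w * β y' v w))
      ≡⟨ cong₂ _+_ (cong₂ _+_ (cong₂ _+_ (incident-pairs x x') (incident-pairs x y')) (incident-pairs y x')) (incident-pairs y y') ⟩
        (+ 2 * k * ⟦ eq x x' ⟧ + + 2 * A x x') + (+ 2 * k * ⟦ eq x y' ⟧ + + 2 * A x y')
          + (+ 2 * k * ⟦ eq y x' ⟧ + + 2 * A y x') + (+ 2 * k * ⟦ eq y y' ⟧ + + 2 * A y y')
      ≡⟨ collect k ⟦ eq x x' ⟧ ⟦ eq x y' ⟧ ⟦ eq y x' ⟧ ⟦ eq y y' ⟧ (A x x') (A x y') (A y x') (A y y') ⟩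
        + 2 * (k * C e g) + + 2 * D e g ∎
      where open ≡-Reasoning

  line-common : ∀ e g → e ∈ es → g ∈ es → LG.common e g ≡ D e g + (k - + 4) * C e g + + 4 * δ e g
  line-common e g e∈ g∈ = begin
      ∑ es (λ h → AL e h * AL h g)
    ≡⟨ ∑-cong-∈ es (λ h h∈ → trans (cong₂ _*_ (AL≡C-2δ e h e∈ h∈) (trans (AL≡C-2δ h g h∈ g∈) (cong (λ z → C h g - + 2 * ⟦ z ⟧) (eqE-sym h g))))
          (expand (C e h) (C h g) (δ e h) (δ g h) (δ e h * δ h g) (cong (δ e h *_) (cong ⟦_⟧ (eqE-sym g h))))) ⟩
      ∑ es (λ h → C e h * C h g - + 2 * (δ e h * C h g) - + 2 * (δ g h * C e h) + + 4 * (δ e h * δ h g))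
    ≡⟨ trans (∑-+ es _ _) (cong₂ _+_ (trans (∑-- es _ _) (cong₂ _-_ (∑-- es _ _) refl)) refl) ⟩
      ∑ es (λ h → C e h * C h g) - ∑ es (λ h → + 2 * (δ e h * C h g)) - ∑ es (λ h → + 2 * (δ g h * C e h)) + ∑ es (λ h → + 4 * (δ e h * δ h g))
    ≡⟨ cong₂ _+_ (cong₂ _-_ (cong₂ _-_ (incidence-walks e g) (trans (∑-*ˡ es (+ 2) _) (cong (+ 2 *_) (LG.collapse e e∈ (λ h → C h g) (C-respˡ g)))))
          (trans (∑-*ˡ es (+ 2) _) (cong (+ 2 *_) (LG.collapse g g∈ (λ h → C e h) (C-respʳ e)))))
          (trans (∑-*ˡ es (+ 4) _) (cong (+ 4 *_) (LG.collapse e e∈ (λ h → δ h g) (δ-respˡ g)))) ⟩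
      k * C e g + D e g - + 2 * C e g - + 2 * C e g + + 4 * δ e g
    ≡⟨ collect k (C e g) (D e g) (δ e g) ⟩
      D e g + (k - + 4) * C e g + + 4 * δ e g ∎
    where
    open ≡-Reasoning
    expand : ∀ c₁ c₂ d₁ d₂ dd → d₁ * d₂ ≡ dd → (c₁ - + 2 * d₁) * (c₂ - + 2 * d₂) ≡ c₁ * c₂ - + 2 * (d₁ * c₂) - + 2 * (d₂ * c₁) + + 4 * dd
    expand c₁ c₂ d₁ d₂ dd refl = ring c₁ c₂ d₁ d₂
      where ring : ∀ c₁ c₂ d₁ d₂ → (c₁ - + 2 * d₁) * (c₂ - + 2 * d₂) ≡ c₁ * c₂ - + 2 * (d₁ * c₂) - + 2 * (d₂ * c₁) + + 4 * (d₁ * d₂)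
            ring = solve-∀
    collect : ∀ k c d t → k * c + d - + 2 * c - + 2 * c + + 4 * t ≡ d + (k - + 4) * c + + 4 * t
    collect = solve-∀

  -- Φ f sums f over pairs of ordered adjacent pairs (x~y, x'~y'); sums over
  -- pairs of edges of L(G) are a quarter of such sums.
  Φ : (V → V → V → V → ℤ) → ℤ
  Φ f = ∑⁴ vs (λ x y x' y' → A x y * (A x' y' * f x y x' y'))

  Φ-cong : ∀ {f g} → (∀ x y x' y' → f x y x' y' ≡ g x y x' y') → Φ f ≡ Φ g
  Φ-cong e = ∑⁴-cong vs (λ x y x' y' → cong (λ z → A x y * (A x' y' * z)) (e x y x' y'))

  Φ-+ : ∀ f g → Φ (λ x y x' y' → f x y x' y' + g x y x' y') ≡ Φ f + Φ g
  Φ-+ f g = trans (∑⁴-cong vs (λ x y x' y' → distrib (A x y) (A x' y') (f x y x' y') (g x y x' y'))) (∑⁴-+ vs _ _)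
    where distrib : ∀ a b u v → a * (b * (u + v)) ≡ a * (b * u) + a * (b * v)
          distrib = solve-∀

  Φ-*ˡ : ∀ c f → Φ (λ x y x' y' → c * f x y x' y') ≡ c * Φ f
  Φ-*ˡ c f = trans (∑⁴-cong vs (λ x y x' y' → reorder (A x y) (A x' y') c (f x y x' y'))) (∑⁴-*ˡ vs c _)
    where reorder : ∀ a b c f → a * (b * (c * f)) ≡ c * (a * (b * f))
          reorder = solve-∀

  Φ-- : ∀ f g → Φ (λ x y x' y' → f x y x' y' - g x y x' y') ≡ Φ f - Φ g
  Φ-- f g = trans (Φ-+ f (λ x y x' y' → - g x y x' y')) (cong (_+_ (Φ f))
    (trans (Φ-cong (λ x y x' y' → neg (g x y x' y'))) (trans (Φ-*ˡ (- 1ℤ) g) (sym (neg (Φ g))))))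
    where neg : ∀ a → - a ≡ (- 1ℤ) * a
          neg = solve-∀

  Φ-swapˡ : ∀ f → Φ (λ x y x' y' → f y x x' y') ≡ Φ f
  Φ-swapˡ f = trans (∑⁴-cong vs (λ x y x' y' → cong (λ z → z * (A x' y' * f y x x' y')) (A-sym x y)))
                    (∑⁴-swap-ab vs (λ x y x' y' → A x y * (A x' y' * f x y x' y')))

  Φ-swapʳ : ∀ f → Φ (λ x y x' y' → f x y y' x') ≡ Φ f
  Φ-swapʳ f = trans (∑⁴-cong vs (λ x y x' y' → cong (λ z → A x y * (z * f x y y' x')) (A-sym x' y')))
                    (∑⁴-swap-cd vs (λ x y x' y' → A x y * (A x' y' * f x y x' y')))

  Φ-outer : ∀ f → Φ f ≡ ∑² (λ x y → A x y * ∑² (λ x' y' → A x' y' * f x y x' y'))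
  Φ-outer f = ∑-cong vs (λ x → ∑-cong vs (λ y → trans (∑-cong vs (λ x' → ∑-*ˡ vs (A x y) _)) (∑-*ˡ vs (A x y) _)))

  edge-pairs : (X : V × V → V × V → ℤ) → (∀ e a b → X e (a , b) ≡ X e (b , a)) → (∀ g a b → X (a , b) g ≡ X (b , a) g) →
    + 4 * ∑ es (λ e → ∑ es (λ g → X e g)) ≡ Φ (λ x y x' y' → X (x , y) (x' , y'))
  edge-pairs X symʳ symˡ = begin
      + 4 * ∑ es (λ e → ∑ es (λ g → X e g))
    ≡⟨ trans (*-assoc (+ 2) (+ 2) _) (cong (+ 2 *_) (sym (∑-*ˡ es (+ 2) (λ e → ∑ es (λ g → X e g))))) ⟩
      + 2 * ∑ es (λ e → + 2 * ∑ es (λ g → X e g))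
    ≡⟨ cong (+ 2 *_) (∑-cong es (λ e → ∑-edges vs (X e) (symʳ e))) ⟩
      + 2 * ∑ es H
    ≡⟨ ∑-edges vs H (λ a b → ∑-cong vs (λ x' → ∑-cong vs (λ y' → cong (A x' y' *_) (symˡ (x' , y') a b)))) ⟩
      ∑² (λ x y → A x y * H (x , y))
    ≡⟨ sym (Φ-outer (λ x y x' y' → X (x , y) (x' , y'))) ⟩
      Φ (λ x y x' y' → X (x , y) (x' , y')) ∎
    where
    open ≡-Reasoning
    H : V × V → ℤ
    H e = ∑² (λ x' y' → A x' y' * X e (x' , y'))

  Φ-orientations : ∀ (f G : V → V → V → V → ℤ) → (∀ x y x' y' → G y x x' y' ≡ G x y x' y') → (∀ x y x' y' → G x y y' x' ≡ G x y x' y') →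
    Φ (λ x y x' y' → (f x y x' y' + f x y y' x' + f y x x' y' + f y x y' x') * G x y x' y') ≡ + 4 * Φ (λ x y x' y' → f x y x' y' * G x y x' y')
  Φ-orientations f G G-swapˡ G-swapʳ = begin
      Φ (λ x y x' y' → (f x y x' y' + f x y y' x' + f y x x' y' + f y x y' x') * G x y x' y')
    ≡⟨ Φ-cong (λ x y x' y' → distrib (f x y x' y') (f x y y' x') (f y x x' y') (f y x y' x') (G x y x' y')) ⟩
      Φ (λ x y x' y' → F₁ x y x' y' + F₂ x y x' y' + F₃ x y x' y' + F₄ x y x' y')
    ≡⟨ trans (Φ-+ (λ x y x' y' → F₁ x y x' y' + F₂ x y x' y' + F₃ x y x' y') F₄)
         (cong (_+ Φ F₄) (trans (Φ-+ (λ x y x' y' → F₁ x y x' y' + F₂ x y x' y') F₃) (cong (_+ Φ F₃) (Φ-+ F₁ F₂)))) ⟩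
      Φ F₁ + Φ F₂ + Φ F₃ + Φ F₄
    ≡⟨ cong₂ _+_ (cong₂ _+_ (cong (_+_ (Φ F₁)) F₂≡F₁) F₃≡F₁) F₄≡F₁ ⟩
      Φ F₁ + Φ F₁ + Φ F₁ + Φ F₁
    ≡⟨ four (Φ F₁) ⟩
      + 4 * Φ F₁ ∎
    where
    open ≡-Reasoning
    distrib : ∀ a b c d g → (a + b + c + d) * g ≡ a * g + b * g + c * g + d * g
    distrib = solve-∀
    four : ∀ a → a + a + a + a ≡ + 4 * a
    four = solve-∀
    F₁ F₂ F₃ F₄ : V → V → V → V → ℤ
    F₁ x y x' y' = f x y x' y' * G x y x' y'
    F₂ x y x' y' = f x y y' x' * G x y x' y'
    F₃ x y x' y' = f y x x' y' * G x y x' y'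
    F₄ x y x' y' = f y x y' x' * G x y x' y'
    F₂≡F₁ : Φ F₂ ≡ Φ F₁
    F₂≡F₁ = trans (Φ-cong (λ x y x' y' → cong (f x y y' x' *_) (sym (G-swapʳ x y x' y')))) (Φ-swapʳ F₁)
    F₃≡F₁ : Φ F₃ ≡ Φ F₁
    F₃≡F₁ = trans (Φ-cong (λ x y x' y' → cong (f y x x' y' *_) (sym (G-swapˡ x y x' y')))) (Φ-swapˡ F₁)
    F₄≡F₁ : Φ F₄ ≡ Φ F₁
    F₄≡F₁ = trans (Φ-cong (λ x y x' y' → cong (f y x y' x' *_) (sym (trans (G-swapˡ x y y' x') (G-swapʳ x y x' y')))))
              (trans (Φ-swapˡ (λ x y x' y' → F₁ x y y' x')) (Φ-swapʳ F₁))

  Φ-at-diagonal : (h : V → V → V → V → ℤ) → (∀ x y y' → Respects (λ x' → A x' y' * h x y x' y')) →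
    Φ (λ x y x' y' → ⟦ eq x x' ⟧ * h x y x' y') ≡ ∑² (λ x y → A x y * ∑ vs (λ y' → A x y' * h x y x y'))
  Φ-at-diagonal h rh = ∑-cong vs (λ x → ∑-cong vs (λ y →
    trans (∑-cong vs (λ x' → ∑-cong vs (λ y' → reorder (A x y) (A x' y') ⟦ eq x x' ⟧ (h x y x' y'))))
    (trans (∑-cong vs (λ x' → ∑-*ˡ vs (A x y) _))
    (trans (∑-*ˡ vs (A x y) _)
    (cong (A x y *_) (trans (∑-cong vs (λ x' → ∑-*ˡ vs ⟦ eq x x' ⟧ (λ y' → A x' y' * h x y x' y')))
      (eval-at x (λ x' → ∑ vs (λ y' → A x' y' * h x y x' y')) (∑-resp (λ y' → rh x y y')))))))))
    where reorder : ∀ a b d h → a * (b * (d * h)) ≡ a * (d * (b * h))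
          reorder = solve-∀

  Φ-eq : Φ (λ x y x' y' → ⟦ eq x x' ⟧) ≡ N * (k * k)
  Φ-eq = trans (Φ-cong (λ x y x' y' → sym (*-identityʳ ⟦ eq x x' ⟧)))
       (trans (Φ-at-diagonal (λ _ _ _ _ → 1ℤ) (λ x y y' a b e → cong (_* 1ℤ) (A-resp y' a b e)))
       (trans (∑-cong vs (λ x → trans (∑-cong vs (λ y → cong (A x y *_) (trans (∑-cong vs (λ y' → *-identityʳ (A x y'))) (regular x))))
                                      (regular-* x k)))
       (∑-const (k * k))))

  Φ-eq-Axx' : Φ (λ x y x' y' → ⟦ eq x x' ⟧ * A x x') ≡ 0ℤ
  Φ-eq-Axx' = trans (Φ-at-diagonal (λ x y x' y' → A x x') (λ x y y' a b e → *-resp (A-resp y') (A-respʳ x) a b e))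
       (trans (∑-cong vs (λ x → ∑-cong vs (λ y → trans (cong (A x y *_)
                 (trans (∑-cong vs (λ y' → trans (cong (A x y' *_) (A-irr x)) (*-zeroʳ (A x y')))) (∑-0 vs))) (*-zeroʳ (A x y)))))
       (trans (∑-cong vs (λ x → ∑-0 vs)) (∑-0 vs)))

  Φ-eq-Axy' : Φ (λ x y x' y' → ⟦ eq x x' ⟧ * A x y') ≡ N * (k * k)
  Φ-eq-Axy' = trans (Φ-at-diagonal (λ x y x' y' → A x y') (λ x y y' a b e → cong (_* A x y') (A-resp y' a b e)))
       (trans (∑-cong vs (λ x → trans (∑-cong vs (λ y → cong (A x y *_) (trans (∑-cong vs (λ y' → A-idem x y')) (regular x))))
                                      (regular-* x k)))
       (∑-const (k * k)))

  Φ-eq-Ayx' : Φ (λ x y x' y' → ⟦ eq x x' ⟧ * A y x') ≡ N * (k * k)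
  Φ-eq-Ayx' = trans (Φ-at-diagonal (λ x y x' y' → A y x') (λ x y y' a b e → *-resp (A-resp y') (A-respʳ y) a b e))
       (trans (∑-cong vs (λ x → trans (∑-cong vs (λ y → trans (cong (A x y *_) (regular-* x (A y x)))
              (trans (cong (λ z → A x y * (k * z)) (A-sym y x)) (trans (reorder (A x y) k) (cong (_* k) (A-idem x y))))))
              (regular-* x k)))
       (∑-const (k * k)))
    where reorder : ∀ a k → a * (k * a) ≡ a * a * k
          reorder = solve-∀

  Φ-eq-Ayy' : Φ (λ x y x' y' → ⟦ eq x x' ⟧ * A y y') ≡ T₃
  Φ-eq-Ayy' = trans (Φ-at-diagonal (λ x y x' y' → A y y') (λ x y y' a b e → cong (_* A y y') (A-resp y' a b e)))
       (∑-cong vs (λ x → ∑-cong vs (λ y → trans (sym (∑-*ˡ vs (A x y) _))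
         (∑-cong vs (λ y' → trans (cong (λ z → A x y * (z * A y y')) (A-sym x y')) (reorder (A x y) (A y' x) (A y y')))))))
    where reorder : ∀ a b c → a * (b * c) ≡ a * (c * b)
          reorder = solve-∀

  Φ-Axx' : Φ (λ x y x' y' → A x x') ≡ N * (k * (k * k))
  Φ-Axx' = trans (Φ-outer _) (trans (∑-cong vs (λ x → trans (∑-cong vs (λ y → cong (A x y *_)
          (trans (∑-cong vs (λ x' → trans (∑-cong vs (λ y' → *-comm (A x' y') (A x x')))
                                          (trans (∑-*ˡ vs (A x x') (A x')) (cong (A x x' *_) (regular x'))))) (regular-* x k))))
          (regular-* x (k * k))))
       (∑-const _))

  Φ-Axx'-Axy' : Φ (λ x y x' y' → A x x' * A x y') ≡ k * T₃
  Φ-Axx'-Axy' = trans (Φ-outer _) (trans (∑-cong vs (λ x → regular-* x _)) (trans (∑-*ˡ vs k _) (cong (k *_) triangles)))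
    where
    reorder : ∀ a b c → a * (b * c) ≡ b * (a * c)
    reorder = solve-∀
    triangles : ∑ vs (λ x → ∑² (λ x' y' → A x' y' * (A x x' * A x y'))) ≡ T₃
    triangles = ∑-cong vs (λ x → ∑-cong vs (λ x' → ∑-cong vs (λ y' →
      trans (cong (λ z → A x' y' * (A x x' * z)) (A-sym x y')) (reorder (A x' y') (A x x') (A y' x)))))

  Φ-Axx'-Ayx' : Φ (λ x y x' y' → A x x' * A y x') ≡ k * T₃
  Φ-Axx'-Ayx' = trans (Φ-outer _) (trans (∑-cong vs (λ x → ∑-cong vs (λ y → cong (A x y *_)
          (trans (∑-cong vs (λ x' → regular-* x' _)) (∑-*ˡ vs k _)))))
       (trans (∑-cong vs (λ x → trans (∑-cong vs (λ y → trans (pull (A x y) k _) (cong (k *_) (sym (∑-*ˡ vs (A x y) _))))) (∑-*ˡ vs k _)))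
       (trans (∑-*ˡ vs k _) (cong (k *_) (∑-cong vs (λ x → ∑-cong vs (λ y → ∑-cong vs (λ x' →
          trans (cong (λ z → A x y * (z * A y x')) (A-sym x x')) (reorder (A x y) (A x' x) (A y x'))))))))))
    where pull : ∀ a k s → a * (k * s) ≡ k * (a * s)
          pull = solve-∀
          reorder : ∀ a b c → a * (b * c) ≡ a * (c * b)
          reorder = solve-∀

  Φ-Axx'-Ayy' : Φ (λ x y x' y' → A x x' * A y y') ≡ T₄
  Φ-Axx'-Ayy' = sym (∑-cong vs (λ x → begin
      ∑ vs (λ y' → common x y' * common x y')
    ≡⟨ ∑-cong vs (λ y' → ∑-product vs vs (λ y → A x y * A y y') (λ x' → A x x' * A x' y')) ⟩
      ∑ vs (λ y' → ∑ vs (λ y → ∑ vs (λ x' → (A x y * A y y') * (A x x' * A x' y'))))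
    ≡⟨ trans (∑-swap vs vs _) (∑-cong vs (λ y → ∑-swap vs vs _)) ⟩
      ∑ vs (λ y → ∑ vs (λ x' → ∑ vs (λ y' → (A x y * A y y') * (A x x' * A x' y'))))
    ≡⟨ ∑-cong vs (λ y → ∑-cong vs (λ x' → ∑-cong vs (λ y' → reorder (A x y) (A y y') (A x x') (A x' y')))) ⟩
      ∑ vs (λ y → ∑ vs (λ x' → ∑ vs (λ y' → A x y * (A x' y' * (A x x' * A y y'))))) ∎))
    where
    open ≡-Reasoning
    reorder : ∀ a b c d → (a * b) * (c * d) ≡ a * (d * (c * b))
    reorder = solve-∀

  C⁴ D⁴ : V → V → V → V → ℤ
  C⁴ x y x' y' = C (x , y) (x' , y')
  D⁴ x y x' y' = D (x , y) (x' , y')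

  D⁴-swapˡ : ∀ x y x' y' → D⁴ y x x' y' ≡ D⁴ x y x' y'
  D⁴-swapˡ x y x' y' = shuffle (A x x') (A x y') (A y x') (A y y')
    where shuffle : ∀ a b c d → c + d + a + b ≡ a + b + c + d
          shuffle = solve-∀

  D⁴-swapʳ : ∀ x y x' y' → D⁴ x y y' x' ≡ D⁴ x y x' y'
  D⁴-swapʳ x y x' y' = shuffle (A x x') (A x y') (A y x') (A y y')
    where shuffle : ∀ a b c d → b + a + d + c ≡ a + b + c + d
          shuffle = solve-∀

  -- C⁴ and D⁴ are the orientation sums of ⟦ x = x' ⟧ and A x x'
  Φ-C : Φ C⁴ ≡ + 4 * (N * (k * k))
  Φ-C = trans (Φ-cong (λ x y x' y' → sym (*-identityʳ (C⁴ x y x' y'))))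
       (trans (Φ-orientations (λ x y x' y' → ⟦ eq x x' ⟧) (λ _ _ _ _ → 1ℤ) (λ _ _ _ _ → refl) (λ _ _ _ _ → refl))
       (cong (+ 4 *_) (trans (Φ-cong (λ x y x' y' → *-identityʳ ⟦ eq x x' ⟧)) Φ-eq)))

  Φ-D : Φ D⁴ ≡ + 4 * (N * (k * (k * k)))
  Φ-D = trans (Φ-cong (λ x y x' y' → sym (*-identityʳ (D⁴ x y x' y'))))
       (trans (Φ-orientations (λ x y x' y' → A x x') (λ _ _ _ _ → 1ℤ) (λ _ _ _ _ → refl) (λ _ _ _ _ → refl))
       (cong (+ 4 *_) (trans (Φ-cong (λ x y x' y' → *-identityʳ (A x x'))) Φ-Axx')))

  Φ-CD : Φ (λ x y x' y' → C⁴ x y x' y' * D⁴ x y x' y') ≡ + 4 * (0ℤ + N * (k * k) + N * (k * k) + T₃)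
  Φ-CD = trans (Φ-orientations (λ x y x' y' → ⟦ eq x x' ⟧) D⁴ D⁴-swapˡ D⁴-swapʳ) (cong (+ 4 *_)
       (trans (Φ-cong (λ x y x' y' → *-distribˡ-+ ⟦ eq x x' ⟧ (A x x' + A x y' + A y x') (A y y')))
       (trans (Φ-+ _ _) (cong₂ _+_
         (trans (Φ-cong (λ x y x' y' → *-distribˡ-+ ⟦ eq x x' ⟧ (A x x' + A x y') (A y x')))
         (trans (Φ-+ _ _) (cong₂ _+_
           (trans (Φ-cong (λ x y x' y' → *-distribˡ-+ ⟦ eq x x' ⟧ (A x x') (A x y')))
           (trans (Φ-+ _ _) (cong₂ _+_ Φ-eq-Axx' Φ-eq-Axy'))) Φ-eq-Ayx'))) Φ-eq-Ayy'))))

  Φ-DD : Φ (λ x y x' y' → D⁴ x y x' y' * D⁴ x y x' y') ≡ + 4 * (N * (k * (k * k)) + k * T₃ + k * T₃ + T₄)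
  Φ-DD = trans (Φ-orientations (λ x y x' y' → A x x') D⁴ D⁴-swapˡ D⁴-swapʳ) (cong (+ 4 *_)
       (trans (Φ-cong (λ x y x' y' → *-distribˡ-+ (A x x') (A x x' + A x y' + A y x') (A y y')))
       (trans (Φ-+ _ _) (cong₂ _+_
         (trans (Φ-cong (λ x y x' y' → *-distribˡ-+ (A x x') (A x x' + A x y') (A y x')))
         (trans (Φ-+ _ _) (cong₂ _+_
           (trans (Φ-cong (λ x y x' y' → *-distribˡ-+ (A x x') (A x x') (A x y')))
           (trans (Φ-+ _ _) (cong₂ _+_ (trans (Φ-cong (λ x y x' y' → A-idem x x')) Φ-Axx') Φ-Axx'-Axy'))) Φ-Axx'-Ayx'))) Φ-Axx'-Ayy'))))

  -- For distinct listed edges λ_L = Λ := D + κ C with κ = k − 4; the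
  -- quadrangle summand λ_L² − λ_L then equals the polynomial Y in C and D,
  -- up to a correction on the diagonal, using C² = C + 2δ.
  κ : ℤ
  κ = k - + 4

  Λ : V × V → V × V → ℤ
  Λ e g = D e g + κ * C e g

  excess : V × V → V × V → ℤ
  excess e g = Λ e g * Λ e g - Λ e g

  Y : V × V → V × V → ℤ
  Y e g = D e g * D e g + + 2 * κ * (C e g * D e g) + κ * κ * C e g - D e g - κ * C e g

  E : ℤ
  E = ∑ es (λ _ → 1ℤ)

  two-E : + 2 * E ≡ N * k
  two-E = trans (∑-edges vs (λ _ → 1ℤ) (λ _ _ → refl))
    (trans (∑-cong vs (λ x → trans (∑-cong vs (λ y → *-identityʳ (A x y))) (regular x))) (∑-const k))

  C²≡C+2δ : ∀ e g → e ∈ es → g ∈ es → C e g * C e g ≡ C e g + + 2 * δ e g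
  C²≡C+2δ e g e∈ g∈ = trans (cong (λ z → z * z) (sym (line-adjacency e g e∈ g∈)))
      (trans (square (adjLine eq e g) (eqE e g) (adjLine-irr e g)) (cong (_+ + 2 * δ e g) (line-adjacency e g e∈ g∈)))
    where square : ∀ a t → (a ≡ true → t ≡ false) → (⟦ a ⟧ + + 2 * ⟦ t ⟧) * (⟦ a ⟧ + + 2 * ⟦ t ⟧) ≡ ⟦ a ⟧ + + 2 * ⟦ t ⟧ + + 2 * ⟦ t ⟧
          square true true h with h refl
          ... | ()
          square true false h = refl
          square false true h = refl
          square false false h = refl

  excess≡Y : ∀ e g → e ∈ es → g ∈ es → excess e g ≡ Y e g + κ * κ * (+ 2 * δ e g)
  excess≡Y e g e∈ g∈ = trans (expand (D e g) (C e g) κ)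
      (trans (cong (λ z → D e g * D e g + + 2 * κ * (C e g * D e g) + κ * κ * z - D e g - κ * C e g) (C²≡C+2δ e g e∈ g∈))
             (regroup (D e g) (C e g) κ (δ e g)))
    where expand : ∀ d c k → (d + k * c) * (d + k * c) - (d + k * c) ≡ d * d + + 2 * k * (c * d) + k * k * (c * c) - d - k * c
          expand = solve-∀
          regroup : ∀ d c k t → d * d + + 2 * k * (c * d) + k * k * (c + + 2 * t) - d - k * c
                                ≡ (d * d + + 2 * k * (c * d) + k * k * c - d - k * c) + k * k * (+ 2 * t)
          regroup = solve-∀

  -- the value of excess on the diagonal, where C = D = 2
  excess-diag : ℤ
  excess-diag = (+ 2 + κ * + 2) * (+ 2 + κ * + 2) - (+ 2 + κ * + 2)

  Y-swapʳ : ∀ e a b → Y e (a , b) ≡ Y e (b , a)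
  Y-swapʳ e a b rewrite C-swapʳ e a b | D-swapʳ e a b = refl

  Y-swapˡ : ∀ g a b → Y (a , b) g ≡ Y (b , a) g
  Y-swapˡ g a b rewrite C-swapˡ g a b | D-swapˡ g a b = refl

  Φ-Y : Φ (λ x y x' y' → Y (x , y) (x' , y')) ≡
        Φ (λ x y x' y' → D⁴ x y x' y' * D⁴ x y x' y') + + 2 * κ * Φ (λ x y x' y' → C⁴ x y x' y' * D⁴ x y x' y')
          + κ * κ * Φ C⁴ - Φ D⁴ - κ * Φ C⁴
  Φ-Y = trans (Φ-- (λ x y x' y' → DD x y x' y' + + 2 * κ * CD x y x' y' + κ * κ * C⁴ x y x' y' - D⁴ x y x' y') (λ x y x' y' → κ * C⁴ x y x' y'))
       (cong₂ _-_ (trans (Φ-- (λ x y x' y' → DD x y x' y' + + 2 * κ * CD x y x' y' + κ * κ * C⁴ x y x' y') D⁴)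
         (cong (_- Φ D⁴) (trans (Φ-+ (λ x y x' y' → DD x y x' y' + + 2 * κ * CD x y x' y') (λ x y x' y' → κ * κ * C⁴ x y x' y'))
           (cong₂ _+_ (trans (Φ-+ DD (λ x y x' y' → + 2 * κ * CD x y x' y')) (cong (_+_ (Φ DD)) (Φ-*ˡ (+ 2 * κ) CD))) (Φ-*ˡ (κ * κ) C⁴)))))
         (Φ-*ˡ κ C⁴))
    where DD CD : V → V → V → V → ℤ
          DD x y x' y' = D⁴ x y x' y' * D⁴ x y x' y'
          CD x y x' y' = C⁴ x y x' y' * D⁴ x y x' y'

  D-diag : ∀ x y → (x , y) ∈ es → D (x , y) (x , y) ≡ + 2
  D-diag x y xy∈ rewrite A-irr x | A-irr y | A-sym y x | proj₂ (proj₂ (∈-edgesOf vs xy∈)) = refl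

  C-diag : ∀ x y → (x , y) ∈ es → C (x , y) (x , y) ≡ + 2
  C-diag x y xy∈ rewrite eq-refl x | eq-refl y | eq-sym y x | adj-irr x y (proj₂ (proj₂ (∈-edgesOf vs xy∈))) = refl

  excess-resp : ∀ e → LG.Respects (λ g → excess e g)
  excess-resp e a b h = cong₂ (λ d c → (d + κ * c) * (d + κ * c) - (d + κ * c)) (D-respʳ e a b h) (C-respʳ e a b h)

  ∑∑excess : ∑ es (λ e → ∑ es (λ g → excess e g)) ≡ ∑ es (λ e → ∑ es (λ g → Y e g)) + E * (κ * κ * + 2)
  ∑∑excess = trans (∑-cong-∈ es (λ e e∈ → trans (∑-cong-∈ es (λ g g∈ → excess≡Y e g e∈ g∈))
      (trans (∑-+ es (Y e) (λ g → κ * κ * (+ 2 * δ e g))) (cong (_+_ (∑ es (Y e)))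
        (trans (∑-*ˡ es (κ * κ) (λ g → + 2 * δ e g)) (trans (cong (κ * κ *_) (trans (∑-*ˡ es (+ 2) (δ e))
          (cong (+ 2 *_) (edge-delta e e∈)))) (reorder κ)))))))
    (trans (∑-+ es (λ e → ∑ es (Y e)) (λ e → 1ℤ * (κ * κ * + 2))) (cong (_+_ (∑ es (λ e → ∑ es (Y e)))) (∑-*ʳ es (κ * κ * + 2) (λ _ → 1ℤ))))
    where reorder : ∀ k → k * k * (+ 2 * 1ℤ) ≡ 1ℤ * (k * k * + 2)
          reorder = solve-∀

  ∑excess-diag : ∑ es (λ e → excess e e) ≡ E * excess-diag
  ∑excess-diag = trans (∑-cong-∈ es (λ { (x , y) xy∈ → trans (cong₂ (λ d c → (d + κ * c) * (d + κ * c) - (d + κ * c)) (D-diag x y xy∈) (C-diag x y xy∈))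
                                                              (sym (*-identityˡ excess-diag)) }))
                       (∑-*ʳ es excess-diag (λ _ → 1ℤ))

  excess-off-diag : ∀ e g → e ∈ es → g ∈ es →
    ⟦ not (eqE e g) ⟧ * (LG.common e g * LG.common e g - LG.common e g) ≡ ⟦ not (eqE e g) ⟧ * excess e g
  excess-off-diag e g e∈ g∈ =
    trans (cong (λ L → ⟦ not (eqE e g) ⟧ * (L * L - L)) (line-common e g e∈ g∈)) (at (eqE e g) (Λ e g))
    where at : ∀ t L → ⟦ not t ⟧ * ((L + + 4 * ⟦ t ⟧) * (L + + 4 * ⟦ t ⟧) - (L + + 4 * ⟦ t ⟧)) ≡ ⟦ not t ⟧ * (L * L - L)
          at true L = refl
          at false L = cong (λ z → 1ℤ * (z * z - z)) (+-identityʳ L)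

  closedWalks4-line-Φ : + 4 * + closedWalks4 es eqE (adjLine eq) ≡
     Φ (λ x y x' y' → D⁴ x y x' y' * D⁴ x y x' y') + + 2 * κ * Φ (λ x y x' y' → C⁴ x y x' y' * D⁴ x y x' y') + κ * κ * Φ C⁴ - Φ D⁴ - κ * Φ C⁴
     + (N * k) * (+ 4 * κ * κ) - (N * k) * (+ 2 * excess-diag)
  closedWalks4-line-Φ = begin
      + 4 * + closedWalks4 es eqE (adjLine eq)
    ≡⟨ cong (+ 4 *_) (trans LG.closedWalks4-formula
         (trans (∑-cong-∈ es (λ e e∈ → ∑-cong-∈ es (λ g g∈ → excess-off-diag e g e∈ g∈))) (LG.∑-off-diagonal excess excess-resp))) ⟩
      + 4 * (∑ es (λ e → ∑ es (λ g → excess e g)) - ∑ es (λ e → excess e e))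
    ≡⟨ cong₂ (λ u v → + 4 * (u - v)) ∑∑excess ∑excess-diag ⟩
      + 4 * (∑Y + E * (κ * κ * + 2) - E * excess-diag)
    ≡⟨ regroup ∑Y E κ excess-diag ⟩
      + 4 * ∑Y + (+ 2 * E) * (+ 4 * κ * κ) - (+ 2 * E) * (+ 2 * excess-diag)
    ≡⟨ cong₂ (λ u v → u + v * (+ 4 * κ * κ) - v * (+ 2 * excess-diag)) (trans (edge-pairs Y Y-swapʳ Y-swapˡ) Φ-Y) two-E ⟩
      _ ∎
    where
    open ≡-Reasoning
    ∑Y : ℤ
    ∑Y = ∑ es (λ e → ∑ es (λ g → Y e g))
    regroup : ∀ s e k c → + 4 * (s + e * (k * k * + 2) - e * c) ≡ + 4 * s + (+ 2 * e) * (+ 4 * k * k) - (+ 2 * e) * (+ 2 * c)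
    regroup = solve-∀

  closedWalks4-line : + closedWalks4 es eqE (adjLine eq) ≡ T₄ + + 4 * (k - + 2) * T₃ + N * k * (k * (k - + 3) * (k - + 3) - + 5)
  closedWalks4-line = line-count-algebra _ N k T₃ T₄ _ _ _ _ Φ-DD Φ-CD Φ-C Φ-D closedWalks4-line-Φ

∑-tabulate : {A : Set} (n : ℕ) (g : Fin n → A) (f : A → ℤ) → ∑ (List.tabulate g) f ≡ ∑ (allFin n) (λ i → f (g i))
∑-tabulate zero g f = refl
∑-tabulate (suc n) g f = cong (_+_ (f (g zero))) (trans (∑-tabulate n (g ∘ suc) f) (sym (∑-tabulate n suc (λ i → f (g i)))))

∑-allFin-suc : (n : ℕ) (f : Fin (suc n) → ℤ) → ∑ (allFin (suc n)) f ≡ f zero + ∑ (allFin n) (λ i → f (suc i))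
∑-allFin-suc n f = cong (_+_ (f zero)) (∑-tabulate n suc f)

∑-allFin-1 : (n : ℕ) → ∑ (allFin n) (λ _ → 1ℤ) ≡ + n
∑-allFin-1 zero = refl
∑-allFin-1 (suc n) = trans (∑-allFin-suc n (λ _ → 1ℤ)) (trans (cong (_+_ 1ℤ) (∑-allFin-1 n)) (sym (pos-+ 1 n)))

∣p∣≡∑ : (n : ℕ) (p : Subset n) → + ∣ p ∣ ≡ ∑ (allFin n) (λ x → ⟦ lookup p x ⟧)
∣p∣≡∑ zero [] = refl
∣p∣≡∑ (suc n) (true ∷ p) = trans (pos-+ 1 ∣ p ∣) (trans (cong (_+_ 1ℤ) (∣p∣≡∑ n p)) (sym (∑-allFin-suc n (λ x → ⟦ lookup (true ∷ p) x ⟧))))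
∣p∣≡∑ (suc n) (false ∷ p) = trans (∣p∣≡∑ n p) (trans (sym (+-identityˡ _)) (sym (∑-allFin-suc n (λ x → ⟦ lookup (false ∷ p) x ⟧))))

infix 4 _≟ᵇ_
_≟ᵇ_ : {n : ℕ} → Fin n → Fin n → Bool
a ≟ᵇ b = ⌊ a ≟ b ⌋

≟ᵇ-sound : {n : ℕ} {a b : Fin n} → (a ≟ᵇ b) ≡ true → a ≡ b
≟ᵇ-sound {a = a} {b} e with a ≟ b
... | yes a≡b = a≡b

≟ᵇ-complete : {n : ℕ} {a b : Fin n} → a ≡ b → (a ≟ᵇ b) ≡ true
≟ᵇ-complete {a = a} {b} a≡b with a ≟ b
... | yes _ = refl
... | no a≢b = ⊥-elim (a≢b a≡b)

≟ᵇ-refl : {n : ℕ} (a : Fin n) → (a ≟ᵇ a) ≡ true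
≟ᵇ-refl a = ≟ᵇ-complete refl

≟ᵇ-suc : {n : ℕ} (a b : Fin n) → (suc a ≟ᵇ suc b) ≡ (a ≟ᵇ b)
≟ᵇ-suc a b with a ≟ b
... | yes _ = refl
... | no _ = refl

≟ᵇ-sym : {n : ℕ} (a b : Fin n) → (a ≟ᵇ b) ≡ (b ≟ᵇ a)
≟ᵇ-sym a b with a ≟ b | b ≟ a
... | yes _ | yes _ = refl
... | no _ | no _ = refl
... | yes a≡b | no b≢a = ⊥-elim (b≢a (sym a≡b))
... | no a≢b | yes b≡a = ⊥-elim (a≢b (sym b≡a))

∑-delta : (n : ℕ) (a : Fin n) → ∑ (allFin n) (λ y → ⟦ a ≟ᵇ y ⟧) ≡ 1ℤ
∑-delta (suc n) zero = trans (∑-allFin-suc n (λ y → ⟦ zero ≟ᵇ y ⟧)) (cong (_+_ 1ℤ) (∑-0 (allFin n)))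
∑-delta (suc n) (suc a) = trans (∑-allFin-suc n (λ y → ⟦ suc a ≟ᵇ y ⟧))
  (trans (+-identityˡ _) (trans (∑-cong (allFin n) (λ y → cong ⟦_⟧ (≟ᵇ-suc a y))) (∑-delta n a)))

∑-collapse : (n : ℕ) (a : Fin n) (f : Fin n → ℤ) → ∑ (allFin n) (λ y → ⟦ a ≟ᵇ y ⟧ * f y) ≡ f a
∑-collapse n a f = trans (∑-cong (allFin n) at-a)
  (trans (∑-*ʳ (allFin n) (f a) _) (trans (cong (_* f a) (∑-delta n a)) (*-identityˡ (f a))))
  where
  at-a : ∀ y → ⟦ a ≟ᵇ y ⟧ * f y ≡ ⟦ a ≟ᵇ y ⟧ * f a
  at-a y with a ≟ᵇ y in e
  ... | true = cong (1ℤ *_) (cong f (sym (≟ᵇ-sound e)))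
  ... | false = refl

∑-involution : (n : ℕ) (σ : Fin n → Fin n) → (∀ b → σ (σ b) ≡ b) → (f : Fin n → ℤ) →
  ∑ (allFin n) (λ b → f (σ b)) ≡ ∑ (allFin n) f
∑-involution n σ σσ f = begin
    ∑ F (λ b → f (σ b))
  ≡⟨ ∑-cong F (λ b → sym (∑-collapse n (σ b) f)) ⟩
    ∑ F (λ b → ∑ F (λ y → ⟦ σ b ≟ᵇ y ⟧ * f y))
  ≡⟨ ∑-swap F F _ ⟩
    ∑ F (λ y → ∑ F (λ b → ⟦ σ b ≟ᵇ y ⟧ * f y))
  ≡⟨ ∑-cong F (λ y → trans (∑-*ʳ F (f y) _) (cong (_* f y) (trans (∑-cong F (λ b → cong ⟦_⟧ (transpose b y))) (∑-delta n (σ y))))) ⟩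
    ∑ F (λ y → 1ℤ * f y)
  ≡⟨ ∑-cong F (λ y → *-identityˡ (f y)) ⟩
    ∑ F f ∎
  where
  open ≡-Reasoning
  F : List (Fin n)
  F = allFin n
  transpose : ∀ b y → (σ b ≟ᵇ y) ≡ (σ y ≟ᵇ b)
  transpose b y with σ b ≟ᵇ y in e₁ | σ y ≟ᵇ b in e₂
  ... | true | true = refl
  ... | false | false = refl
  ... | true | false = sym (trans (sym e₂) (trans (cong (λ z → σ z ≟ᵇ b) (sym (≟ᵇ-sound e₁))) (trans (cong (_≟ᵇ b) (σσ b)) (≟ᵇ-refl b))))
  ... | false | true = trans (sym e₁) (trans (cong (λ z → σ z ≟ᵇ y) (sym (≟ᵇ-sound e₂))) (trans (cong (_≟ᵇ y) (σσ y)) (≟ᵇ-refl y)))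

any-sound : {A : Set} (p : A → Bool) (xs : List A) → any p xs ≡ true → Σ A (λ y → p y ≡ true)
any-sound p (x ∷ xs) e with p x in px
... | true = x , px
... | false = any-sound p xs e

any-complete : {A : Set} (p : A → Bool) (xs : List A) {y : A} → y ∈ xs → p y ≡ true → any p xs ≡ true
any-complete p (x ∷ xs) (here refl) e rewrite e = refl
any-complete p (x ∷ xs) (there y∈) e with p x
... | true = refl
... | false = any-complete p xs y∈ e

allSubsets : (n : ℕ) → List (Subset n)
allSubsets zero = [] ∷ []
allSubsets (suc n) = map (true ∷_) (allSubsets n) ++ map (false ∷_) (allSubsets n)

∈-allSubsets : ∀ {n} (p : Subset n) → p ∈ allSubsets n
∈-allSubsets [] = here refl
∈-allSubsets {suc n} (true ∷ p) = ++⁺ˡ (map⁺ (Any.map (cong (true ∷_)) (∈-allSubsets p)))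
∈-allSubsets {suc n} (false ∷ p) = ++⁺ʳ (map (true ∷_) (allSubsets n)) (map⁺ (Any.map (cong (false ∷_)) (∈-allSubsets p)))

full⇒⊤ : ∀ {n} (p : Subset n) → (∀ x → x ∈ˢ p) → p ≡ ⊤
full⇒⊤ [] h = refl
full⇒⊤ (b ∷ p) h with h zero
... | Vec.here = cong (true ∷_) (full⇒⊤ p (λ x → drop (h (suc x))))
  where drop : ∀ {n} {x : Fin n} {b p} → suc x ∈ˢ (b ∷ p) → x ∈ˢ p
        drop (Vec.there x∈) = x∈

module FiniteRing {n : ℕ} (R : FinCRing n) where
  open FinCRing R renaming (_+_ to _+ᴿ_; _*_ to _*ᴿ_; -_ to -ᴿ_)
  open IsCommutativeRing isCommutativeRing using (zeroˡ; distribʳ; -‿inverseˡ; -‿inverseʳ)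
    renaming (+-assoc to +ᴿ-assoc; +-comm to +ᴿ-comm; *-assoc to *ᴿ-assoc; *-comm to *ᴿ-comm;
              *-identityˡ to *ᴿ-identityˡ; *-identityʳ to *ᴿ-identityʳ; +-identityˡ to +ᴿ-identityˡ; +-identityʳ to +ᴿ-identityʳ)
  open import Algebra.Bundles using (CommutativeRing)
  private
    ring : CommutativeRing _ _
    ring = record { Carrier = Fin n ; _≈_ = _≡_ ; _+_ = _+ᴿ_ ; _*_ = _*ᴿ_ ; -_ = -ᴿ_ ; 0# = 0# ; 1# = 1# ; isCommutativeRing = isCommutativeRing }
  open import Algebra.Properties.Ring (CommutativeRing.ring ring) using (-‿distribˡ-*; ⁻¹-anti-homo‿-)

  isUnit : Fin n → Bool
  isUnit = isUnitᵇ R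

  unit-sound : ∀ x → isUnit x ≡ true → Σ (Fin n) (λ y → x *ᴿ y ≡ 1#)
  unit-sound x e with any-sound _ (allFin n) e
  ... | y , xy≟1 = y , ≟ᵇ-sound xy≟1

  unit-complete : ∀ x y → x *ᴿ y ≡ 1# → isUnit x ≡ true
  unit-complete x y e = any-complete (λ y → x *ᴿ y ≟ᵇ 1#) (allFin n) (∈-allFin y) (≟ᵇ-complete e)

  _−_ : Fin n → Fin n → Fin n
  a − b = a +ᴿ (-ᴿ b)

  −-anti : ∀ a b → -ᴿ (a − b) ≡ b − a
  −-anti = ⁻¹-anti-homo‿-

  −-self : ∀ a → a − a ≡ 0#
  −-self = -‿inverseʳ

  −-chain : ∀ a b c → (a − b) +ᴿ (b − c) ≡ a − c
  −-chain a b c = begin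
      (a − b) +ᴿ (b − c)          ≡⟨ +ᴿ-assoc a (-ᴿ b) (b − c) ⟩
      a +ᴿ ((-ᴿ b) +ᴿ (b +ᴿ (-ᴿ c)))  ≡⟨ cong (a +ᴿ_) (sym (+ᴿ-assoc (-ᴿ b) b (-ᴿ c))) ⟩
      a +ᴿ (((-ᴿ b) +ᴿ b) +ᴿ (-ᴿ c))  ≡⟨ cong (λ z → a +ᴿ (z +ᴿ (-ᴿ c))) (-‿inverseˡ b) ⟩
      a +ᴿ (0# +ᴿ (-ᴿ c))           ≡⟨ cong (a +ᴿ_) (+ᴿ-identityˡ (-ᴿ c)) ⟩
      a − c                      ∎
    where open ≡-Reasoning

  −-involutive : ∀ a b → a − (a − b) ≡ b
  −-involutive a b = begin
      a +ᴿ (-ᴿ (a − b))    ≡⟨ cong (a +ᴿ_) (−-anti a b) ⟩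
      a +ᴿ (b − a)        ≡⟨ +ᴿ-comm a (b − a) ⟩
      (b +ᴿ (-ᴿ a)) +ᴿ a    ≡⟨ +ᴿ-assoc b (-ᴿ a) a ⟩
      b +ᴿ ((-ᴿ a) +ᴿ a)    ≡⟨ cong (b +ᴿ_) (-‿inverseˡ a) ⟩
      b +ᴿ 0#             ≡⟨ +ᴿ-identityʳ b ⟩
      b                  ∎
    where open ≡-Reasoning

  dec-ideal : (J : Subset n) → Dec (IsIdeal R J)
  dec-ideal J with (0# ∈? J) ×-dec all? (λ x → all? (λ y → (x ∈? J) →-dec ((y ∈? J) →-dec ((x +ᴿ y) ∈? J))))
                   ×-dec all? (λ x → (x ∈? J) →-dec ((-ᴿ x) ∈? J))
                   ×-dec all? (λ r → all? (λ x → (x ∈? J) →-dec ((r *ᴿ x) ∈? J)))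
  ... | yes (z , a , ng , m) = yes (record { zero∈ = z ; +-closed = a ; neg-closed = ng ; mul-closed = m })
  ... | no ¬ideal = no (λ I → ¬ideal (IsIdeal.zero∈ I , IsIdeal.+-closed I , IsIdeal.neg-closed I , IsIdeal.mul-closed I))

  dec-⊤ : (J : Subset n) → Dec (J ≡ ⊤)
  dec-⊤ J = VecP.≡-dec _≟𝔹_ J ⊤

  ProperAbove : Subset n → Subset n → Set
  ProperAbove I J = IsIdeal R J × I ⊂ J × ¬ (J ≡ ⊤)

  dec-ProperAbove : ∀ I J → Dec (ProperAbove I J)
  dec-ProperAbove I J = dec-ideal J ×-dec (I ⊂? J) ×-dec ¬? (dec-⊤ J)

  -- every proper ideal lies in a maximal ideal (by search, on the measure n − |I|)
  maximal-above : (fuel : ℕ) (I : Subset n) → IsIdeal R I → ¬ (I ≡ ⊤) → n ∸ ∣ I ∣ ℕ.≤ fuel →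
    Σ (Subset n) (λ J → IsMaximalIdeal R J × I ⊆ J)
  maximal-above fuel I I-ideal I≢⊤ bound with any? (dec-ProperAbove I) (allSubsets n)
  ... | no nothing-above = I , record { ideal = I-ideal ; proper = I≢⊤ ; maximal = maximal } , (λ {y} y∈ → y∈)
    where
    maximal : ∀ J → IsIdeal R J → I ⊆ J → J ≡ I ⊎ J ≡ ⊤
    maximal J J-ideal I⊆J with dec-⊤ J
    ... | yes J≡⊤ = inj₂ J≡⊤
    ... | no J≢⊤ = inj₁ (⊆-antisym J⊆I I⊆J)
      where
      J⊆I : J ⊆ I
      J⊆I {x} x∈J with x ∈? I
      ... | yes x∈I = x∈I
      ... | no x∉I = ⊥-elim (nothing-above (Any.map (λ { refl → J-ideal , ((λ {y} → I⊆J {y}) , x , x∈J , x∉I) , J≢⊤ }) (∈-allSubsets J)))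
  ... | yes above with Any.satisfied above
  ...   | J , (J-ideal , I⊂J , J≢⊤) with fuel
  ...     | zero = ⊥-elim (ℕP.<-irrefl refl (ℕP.≤-trans (p⊂q⇒∣p∣<∣q∣ I⊂J) (ℕP.≤-trans (∣p∣≤n J) (ℕP.m∸n≡0⇒m≤n (ℕP.n≤0⇒n≡0 bound)))))
  ...     | suc fuel′ with maximal-above fuel′ J J-ideal J≢⊤ (ℕP.<⇒≤pred (ℕP.<-≤-trans (ℕP.∸-monoʳ-< (p⊂q⇒∣p∣<∣q∣ I⊂J) (∣p∣≤n J)) bound))
  ...       | K , K-maximal , J⊆K = K , K-maximal , (λ {y} y∈ → J⊆K (proj₁ I⊂J y∈))

  multiples : Fin n → Subset n
  multiples x = tabulate (λ y → any (λ r → r *ᴿ x ≟ᵇ y) (allFin n))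

  ∈-multiples : ∀ x y r → r *ᴿ x ≡ y → y ∈ˢ multiples x
  ∈-multiples x y r e = VecP.lookup⇒[]= y (multiples x)
    (trans (VecP.lookup∘tabulate _ y) (any-complete (λ r → r *ᴿ x ≟ᵇ y) (allFin n) (∈-allFin r) (≟ᵇ-complete e)))

  ∈-multiples⁻ : ∀ x y → y ∈ˢ multiples x → Σ (Fin n) (λ r → r *ᴿ x ≡ y)
  ∈-multiples⁻ x y y∈ with any-sound _ (allFin n) (trans (sym (VecP.lookup∘tabulate _ y)) (VecP.[]=⇒lookup y∈))
  ... | r , rx≟y = r , ≟ᵇ-sound rx≟y

  multiples-ideal : ∀ x → IsIdeal R (multiples x)
  multiples-ideal x = record
    { zero∈ = ∈-multiples x 0# 0# (zeroˡ x)
    ; +-closed = λ a b a∈ b∈ → let (r , ra) = ∈-multiples⁻ x a a∈ ; (s , sb) = ∈-multiples⁻ x b b∈ in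
                  ∈-multiples x (a +ᴿ b) (r +ᴿ s) (trans (distribʳ x r s) (cong₂ _+ᴿ_ ra sb))
    ; neg-closed = λ a a∈ → let (r , ra) = ∈-multiples⁻ x a a∈ in ∈-multiples x (-ᴿ a) (-ᴿ r) (trans (sym (-‿distribˡ-* r x)) (cong -ᴿ_ ra))
    ; mul-closed = λ t a a∈ → let (r , ra) = ∈-multiples⁻ x a a∈ in ∈-multiples x (t *ᴿ a) (t *ᴿ r) (trans (*ᴿ-assoc t r x) (cong (t *ᴿ_) ra))
    }

  -- a non-unit generates a proper ideal, hence lies in a maximal ideal
  nonunit-in-maximal : ∀ x → isUnit x ≡ false → Σ (Subset n) (λ J → IsMaximalIdeal R J × x ∈ˢ J)
  nonunit-in-maximal x nonunit with maximal-above n (multiples x) (multiples-ideal x) proper (ℕP.m∸n≤m n ∣ multiples x ∣)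
    where
    proper : ¬ (multiples x ≡ ⊤)
    proper e with ∈-multiples⁻ x 1# (subst (1# ∈ˢ_) (sym e) ∈⊤)
    ... | r , rx≡1 = conflict nonunit (unit-complete x r (trans (*ᴿ-comm x r) rx≡1))
  ... | J , J-maximal , ⊆J = J , J-maximal , ⊆J (∈-multiples x x 1# (*ᴿ-identityˡ x))

module LocalRing {n : ℕ} (R : FinCRing n) (M : Subset n) (local : IsLocalWithMaximalIdeal R M) where
  open FinCRing R renaming (_+_ to _+ᴿ_; _*_ to _*ᴿ_; -_ to -ᴿ_)
  open IsCommutativeRing isCommutativeRing using () renaming (+-comm to +ᴿ-comm; *-comm to *ᴿ-comm; *-identityʳ to *ᴿ-identityʳ)
  open FiniteRing R public
  open IsMaximalIdeal (proj₁ local)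
  open IsIdeal ideal

  inM : Fin n → Bool
  inM x = lookup M x

  inM⇒∈ : ∀ {x} → inM x ≡ true → x ∈ˢ M
  inM⇒∈ {x} e = VecP.lookup⇒[]= x M e

  ∈⇒inM : ∀ {x} → x ∈ˢ M → inM x ≡ true
  ∈⇒inM x∈ = VecP.[]=⇒lookup x∈

  unit∉M : ∀ x → isUnit x ≡ true → x ∉ M
  unit∉M x unit x∈M with unit-sound x unit
  ... | y , xy≡1 = proper (full⇒⊤ M (λ r → subst (_∈ˢ M) (*ᴿ-identityʳ r) (mul-closed r 1# 1∈M)))
    where 1∈M : 1# ∈ˢ M
          1∈M = subst (_∈ˢ M) (trans (*ᴿ-comm y x) xy≡1) (mul-closed y x x∈M)

  nonunit∈M : ∀ x → isUnit x ≡ false → x ∈ˢ M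
  nonunit∈M x nonunit with nonunit-in-maximal x nonunit
  ... | J , J-maximal , x∈J = subst (x ∈ˢ_) (proj₂ local J J-maximal) x∈J

  unit⇔∉M : ∀ x → isUnit x ≡ not (inM x)
  unit⇔∉M x with isUnit x in u | inM x in m
  ... | true | false = refl
  ... | false | true = refl
  ... | true | true = ⊥-elim (unit∉M x u (inM⇒∈ m))
  ... | false | false = ⊥-elim (conflict m (∈⇒inM (nonunit∈M x u)))

  inM-flip : ∀ a b → inM (a − b) ≡ true → inM (b − a) ≡ true
  inM-flip a b e = subst (λ z → inM z ≡ true) (−-anti a b) (∈⇒inM (neg-closed _ (inM⇒∈ e)))

  inM-anti : ∀ a b → inM (a − b) ≡ inM (b − a)
  inM-anti a b with inM (a − b) in e₁ | inM (b − a) in e₂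
  ... | true | true = refl
  ... | false | false = refl
  ... | true | false = ⊥-elim (conflict e₂ (inM-flip a b e₁))
  ... | false | true = ⊥-elim (conflict e₁ (inM-flip b a e₂))

  inM-chain : ∀ a b c → inM (a − b) ≡ true → inM (b − c) ≡ inM (a − c)
  inM-chain a b c ab with inM (b − c) in e₁ | inM (a − c) in e₂
  ... | true | true = refl
  ... | false | false = refl
  ... | true | false = ⊥-elim (conflict e₂ (subst (λ z → inM z ≡ true) (−-chain a b c) (∈⇒inM (+-closed _ _ (inM⇒∈ ab) (inM⇒∈ e₁)))))
  ... | false | true = ⊥-elim (conflict e₁ (subst (λ z → inM z ≡ true) (trans (+ᴿ-comm (a − c) (b − a)) (−-chain b a c))
                                (∈⇒inM (+-closed _ _ (inM⇒∈ e₂) (inM⇒∈ (inM-flip a b ab))))))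

  self∉units : ∀ a → isUnit (a − a) ≡ false
  self∉units a = trans (unit⇔∉M (a − a)) (cong not (trans (cong inM (−-self a)) (∈⇒inM zero∈)))

module LocalCounts {n : ℕ} (R : FinCRing n) (M : Subset n) (local : IsLocalWithMaximalIdeal R M) where
  open LocalRing R M local public

  F : List (Fin n)
  F = allFin n

  μ u : Fin n → ℤ
  μ x = ⟦ inM x ⟧
  u x = ⟦ isUnit x ⟧

  m N U : ℤ
  m = + ∣ M ∣
  N = + n
  U = + unitCount R

  u≡1-μ : ∀ x → u x ≡ 1ℤ - μ x
  u≡1-μ x = trans (cong ⟦_⟧ (unit⇔∉M x)) (⟦not⟧ (inM x))

  ∑μ : ∑ F μ ≡ m
  ∑μ = sym (∣p∣≡∑ n M)

  -- b ↦ a − b is an involution, so each translate of M has |M| elements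
  ∑μ-translate : ∀ a → ∑ F (λ b → μ (a − b)) ≡ m
  ∑μ-translate a = trans (∑-involution n (a −_) (−-involutive a) μ) ∑μ

  ∑μ-translate′ : ∀ c → ∑ F (λ b → μ (b − c)) ≡ m
  ∑μ-translate′ c = trans (∑-cong F (λ b → cong ⟦_⟧ (inM-anti b c))) (∑μ-translate c)

  ∑-const : ∀ c → ∑ F (λ _ → c) ≡ N * c
  ∑-const c = trans (∑-cong F (λ _ → sym (*-identityˡ c))) (trans (∑-*ʳ F c (λ _ → 1ℤ)) (cong (_* c) (∑-allFin-1 n)))

  ∑-complement : ∀ (g : Fin n → Fin n) → ∑ F (λ b → μ (g b)) ≡ m → ∑ F (λ b → 1ℤ - μ (g b)) ≡ N - m
  ∑-complement g h = trans (∑-- F (λ _ → 1ℤ) (λ b → μ (g b))) (cong₂ _-_ (∑-allFin-1 n) h)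

  U≡N-m : U ≡ N - m
  U≡N-m = trans (count≡∑ isUnit F) (trans (∑-cong F u≡1-μ) (∑-complement (λ x → x) ∑μ))

  N≡U+m : N ≡ U + m
  N≡U+m = trans (split N m) (cong (_+ m) (sym U≡N-m))
    where split : ∀ n m → n ≡ (n - m) + m
          split = solve-∀

  degree : ∀ a → ∑ F (λ b → u (a − b)) ≡ U
  degree a = trans (∑-cong F (λ b → u≡1-μ (a − b))) (trans (∑-complement (a −_) (∑μ-translate a)) (sym U≡N-m))

  common : Fin n → Fin n → ℤ
  common a c = ∑ F (λ b → u (a − b) * u (b − c))

  μ-chain : ∀ a b c → μ (a − b) * μ (b − c) ≡ μ (a − c) * μ (a − b)
  μ-chain a b c with inM (a − b) in e
  ... | false = trans (*-zeroˡ (μ (b − c))) (sym (*-zeroʳ (μ (a − c))))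
  ... | true = trans (*-identityˡ _) (trans (cong ⟦_⟧ (inM-chain a b c e)) (sym (*-identityʳ _)))

  common≡ : ∀ a c → common a c ≡ N - + 2 * m + m * μ (a − c)
  common≡ a c = begin
      common a c
    ≡⟨ ∑-cong F (λ b → trans (cong₂ _*_ (u≡1-μ (a − b)) (u≡1-μ (b − c)))
          (trans (expand (μ (a − b)) (μ (b − c))) (cong (_+_ ((1ℤ - μ (a − b)) - μ (b − c))) (μ-chain a b c)))) ⟩
      ∑ F (λ b → (1ℤ - μ (a − b)) - μ (b − c) + μ (a − c) * μ (a − b))
    ≡⟨ trans (∑-+ F _ _) (cong₂ _+_ (trans (∑-- F _ _) (cong₂ _-_ (∑-complement (a −_) (∑μ-translate a)) (∑μ-translate′ c)))
                                     (trans (∑-*ˡ F (μ (a − c)) _) (cong (μ (a − c) *_) (∑μ-translate a)))) ⟩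
      N - m - m + μ (a − c) * m
    ≡⟨ collect N m (μ (a − c)) ⟩
      N - + 2 * m + m * μ (a − c) ∎
    where
    open ≡-Reasoning
    expand : ∀ p q → (1ℤ - p) * (1ℤ - q) ≡ (1ℤ - p) - q + p * q
    expand = solve-∀
    collect : ∀ n m x → n - m - m + x * m ≡ n - + 2 * m + m * x
    collect = solve-∀

  ∑common² : ∑ F (λ a → ∑ F (λ c → common a c * common a c)) ≡ N * (U * (U * U - U * m + m * m))
  ∑common² = begin
      ∑ F (λ a → ∑ F (λ c → common a c * common a c))
    ≡⟨ ∑-cong F (λ a → ∑-cong F (λ c → trans (cong (λ z → z * z) (common≡ a c)) (square K m (μ (a − c)) (⟦⟧-idem (inM (a − c)))))) ⟩
      ∑ F (λ a → ∑ F (λ c → K * K + (+ 2 * K * m + m * m) * μ (a − c)))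
    ≡⟨ ∑-cong F (λ a → trans (∑-+ F _ _) (cong₂ _+_ (∑-const (K * K))
          (trans (∑-*ˡ F (+ 2 * K * m + m * m) (λ c → μ (a − c))) (cong ((+ 2 * K * m + m * m) *_) (∑μ-translate a))))) ⟩
      ∑ F (λ a → N * (K * K) + (+ 2 * K * m + m * m) * m)
    ≡⟨ ∑-const _ ⟩
      N * (N * (K * K) + (+ 2 * K * m + m * m) * m)
    ≡⟨ cong (λ z → z * (z * ((z - + 2 * m) * (z - + 2 * m)) + (+ 2 * (z - + 2 * m) * m + m * m) * m)) N≡U+m ⟩
      (U + m) * ((U + m) * (((U + m) - + 2 * m) * ((U + m) - + 2 * m)) + (+ 2 * ((U + m) - + 2 * m) * m + m * m) * m)
    ≡⟨ normalise U m ⟩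
      (U + m) * (U * (U * U - U * m + m * m))
    ≡⟨ cong (λ z → z * (U * (U * U - U * m + m * m))) (sym N≡U+m) ⟩
      N * (U * (U * U - U * m + m * m)) ∎
    where
    open ≡-Reasoning
    K : ℤ
    K = N - + 2 * m
    square : ∀ k m x → x * x ≡ x → (k + m * x) * (k + m * x) ≡ k * k + (+ 2 * k * m + m * m) * x
    square k m x x²≡x = trans (expand k m x) (trans (cong (λ z → k * k + + 2 * k * m * x + m * m * z) x²≡x) (collect k m x))
      where expand : ∀ k m x → (k + m * x) * (k + m * x) ≡ k * k + + 2 * k * m * x + m * m * (x * x)
            expand = solve-∀
            collect : ∀ k m x → k * k + + 2 * k * m * x + m * m * x ≡ k * k + (+ 2 * k * m + m * m) * x
            collect = solve-∀
    normalise : ∀ u m → (u + m) * ((u + m) * (((u + m) - + 2 * m) * ((u + m) - + 2 * m)) + (+ 2 * ((u + m) - + 2 * m) * m + m * m) * m)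
                        ≡ (u + m) * (u * (u * u - u * m + m * m))
    normalise = solve-∀

  ∑triangles : ∑ F (λ a → ∑ F (λ c → u (a − c) * common a c)) ≡ N * (U * (U - m))
  ∑triangles = begin
      ∑ F (λ a → ∑ F (λ c → u (a − c) * common a c))
    ≡⟨ ∑-cong F (λ a → ∑-cong F (λ c → trans (cong₂ _*_ (u≡1-μ (a − c)) (common≡ a c)) (unit-times K m (μ (a − c)) (⟦⟧-idem (inM (a − c)))))) ⟩
      ∑ F (λ a → ∑ F (λ c → K - K * μ (a − c)))
    ≡⟨ ∑-cong F (λ a → trans (∑-- F _ _) (cong₂ _-_ (∑-const K) (trans (∑-*ˡ F K (λ c → μ (a − c))) (cong (K *_) (∑μ-translate a))))) ⟩
      ∑ F (λ a → N * K - K * m)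
    ≡⟨ ∑-const _ ⟩
      N * (N * K - K * m)
    ≡⟨ cong (λ z → z * (z * (z - + 2 * m) - (z - + 2 * m) * m)) N≡U+m ⟩
      (U + m) * ((U + m) * ((U + m) - + 2 * m) - ((U + m) - + 2 * m) * m)
    ≡⟨ normalise U m ⟩
      (U + m) * (U * (U - m))
    ≡⟨ cong (λ z → z * (U * (U - m))) (sym N≡U+m) ⟩
      N * (U * (U - m)) ∎
    where
    open ≡-Reasoning
    K : ℤ
    K = N - + 2 * m
    unit-times : ∀ k m x → x * x ≡ x → (1ℤ - x) * (k + m * x) ≡ k - k * x
    unit-times k m x x²≡x = trans (expand k m x) (trans (cong (λ z → k - k * x + m * x - m * z) x²≡x) (cancel k m x))
      where expand : ∀ k m x → (1ℤ - x) * (k + m * x) ≡ k - k * x + m * x - m * (x * x)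
            expand = solve-∀
            cancel : ∀ k m x → k - k * x + m * x - m * x ≡ k - k * x
            cancel = solve-∀
    normalise : ∀ u m → (u + m) * ((u + m) * ((u + m) - + 2 * m) - ((u + m) - + 2 * m) * m) ≡ (u + m) * (u * (u - m))
    normalise = solve-∀

∏-cong : (s : ℕ) {f g : Fin s → ℤ} → (∀ i → f i ≡ g i) → ∏ s f ≡ ∏ s g
∏-cong zero e = refl
∏-cong (suc s) e = cong₂ _*_ (e zero) (∏-cong s (λ i → e (suc i)))

∏-* : (s : ℕ) (f g : Fin s → ℤ) → ∏ s (λ i → f i * g i) ≡ ∏ s f * ∏ s g
∏-* zero f g = refl
∏-* (suc s) f g = trans (cong (f zero * g zero *_) (∏-* s (λ i → f (suc i)) (λ i → g (suc i)))) (interchange (f zero) (g zero) _ _)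
  where interchange : ∀ a b c d → a * b * (c * d) ≡ a * c * (b * d)
        interchange = solve-∀

∏-1 : (s : ℕ) → ∏ s (λ _ → 1ℤ) ≡ 1ℤ
∏-1 zero = refl
∏-1 (suc s) = trans (*-identityˡ _) (∏-1 s)

∏-0 : (s : ℕ) (f : Fin s → ℤ) (i : Fin s) → f i ≡ 0ℤ → ∏ s f ≡ 0ℤ
∏-0 (suc s) f zero e = trans (cong (_* ∏ s (λ i → f (suc i))) e) (*-zeroˡ (∏ s (λ i → f (suc i))))
∏-0 (suc s) f (suc i) e = trans (cong (f zero *_) (∏-0 s (λ j → f (suc j)) i e)) (*-zeroʳ (f zero))

∑-∏ : (s : ℕ) (n : Fin s → ℕ) (f : (i : Fin s) → Fin (n i) → ℤ) →
  ∑ (enumProd s n) (λ x → ∏ s (λ i → f i (x i))) ≡ ∏ s (λ i → ∑ (allFin (n i)) (f i))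
∑-∏ zero n f = +-identityʳ _
∑-∏ (suc s) n f = begin
    ∑ (enumProd (suc s) n) (λ x → ∏ (suc s) (λ i → f i (x i)))
  ≡⟨ ∑-concatMap _ (allFin (n zero)) _ ⟩
    ∑ (allFin (n zero)) (λ a → ∑ (map (consP {s} {n} a) (enumProd s (λ i → n (suc i)))) (λ x → ∏ (suc s) (λ i → f i (x i))))
  ≡⟨ ∑-cong (allFin (n zero)) (λ a → ∑-map (consP {s} {n} a) (enumProd s (λ i → n (suc i))) _) ⟩
    ∑ (allFin (n zero)) (λ a → ∑ (enumProd s (λ i → n (suc i))) (λ g → f zero a * ∏ s (λ i → f (suc i) (g i))))
  ≡⟨ ∑-cong (allFin (n zero)) (λ a → trans (∑-*ˡ (enumProd s (λ i → n (suc i))) (f zero a) _)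
                                         (cong (f zero a *_) (∑-∏ s (λ i → n (suc i)) (λ i → f (suc i))))) ⟩
    ∑ (allFin (n zero)) (λ a → f zero a * ∏ s (λ i → ∑ (allFin (n (suc i))) (f (suc i))))
  ≡⟨ ∑-*ʳ (allFin (n zero)) _ (f zero) ⟩
    ∏ (suc s) (λ i → ∑ (allFin (n i)) (f i)) ∎
  where open ≡-Reasoning

all-tabulate : {A : Set} (s : ℕ) (g : Fin s → A) (p : A → Bool) → all p (List.tabulate g) ≡ all (λ i → p (g i)) (allFin s)
all-tabulate zero g p = refl
all-tabulate (suc s) g p = cong (p (g zero) ∧_) (trans (all-tabulate s (g ∘ suc) p) (sym (all-tabulate s suc (λ i → p (g i)))))

all-suc : (s : ℕ) (p : Fin (suc s) → Bool) → all p (allFin (suc s)) ≡ p zero ∧ all (λ i → p (suc i)) (allFin s)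
all-suc s p = cong (p zero ∧_) (all-tabulate s suc p)

all-complete : (s : ℕ) (p : Fin s → Bool) → (∀ i → p i ≡ true) → all p (allFin s) ≡ true
all-complete zero p h = refl
all-complete (suc s) p h rewrite all-suc s p | h zero = all-complete s (λ i → p (suc i)) (λ i → h (suc i))

all-sound : (s : ℕ) (p : Fin s → Bool) → all p (allFin s) ≡ true → ∀ i → p i ≡ true
all-sound (suc s) p e i rewrite all-suc s p with p zero in p₀
all-sound (suc s) p e zero | true = p₀
all-sound (suc s) p e (suc i) | true = all-sound s (λ i → p (suc i)) e i

⟦all⟧≡∏ : (s : ℕ) (p : Fin s → Bool) → ⟦ all p (allFin s) ⟧ ≡ ∏ s (λ i → ⟦ p i ⟧)
⟦all⟧≡∏ zero p = refl
⟦all⟧≡∏ (suc s) p = trans (cong ⟦_⟧ (all-suc s p)) (trans (⟦∧⟧ (p zero) _) (cong (⟦ p zero ⟧ *_) (⟦all⟧≡∏ s (λ i → p (suc i)))))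

eqV : (s : ℕ) {n : Fin s → ℕ} → Prod s n → Prod s n → Bool
eqV s x y = all (λ i → x i ≟ᵇ y i) (allFin s)

eqV-sound : (s : ℕ) {n : Fin s → ℕ} (x y : Prod s n) → eqV s x y ≡ true → ∀ i → x i ≡ y i
eqV-sound s x y e i = ≟ᵇ-sound (all-sound s (λ i → x i ≟ᵇ y i) e i)

eqV-complete : (s : ℕ) {n : Fin s → ℕ} (x y : Prod s n) → (∀ i → x i ≡ y i) → eqV s x y ≡ true
eqV-complete s x y h = all-complete s (λ i → x i ≟ᵇ y i) (λ i → ≟ᵇ-complete (h i))

_<ᵇ_ : {n : ℕ} → Fin n → Fin n → Bool
zero <ᵇ zero = false
zero <ᵇ suc _ = true
suc _ <ᵇ zero = false
suc a <ᵇ suc b = a <ᵇ b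

<ᵇ-total : {n : ℕ} (a b : Fin n) → (a ≟ᵇ b) ≡ false → ⟦ a <ᵇ b ⟧ + ⟦ b <ᵇ a ⟧ ≡ 1ℤ
<ᵇ-total zero zero ()
<ᵇ-total zero (suc b) e = refl
<ᵇ-total (suc a) zero e = refl
<ᵇ-total (suc a) (suc b) e = <ᵇ-total a b (trans (sym (≟ᵇ-suc a b)) e)

<ᵇ-irrefl : {n : ℕ} (a : Fin n) → (a <ᵇ a) ≡ false
<ᵇ-irrefl zero = refl
<ᵇ-irrefl (suc a) = <ᵇ-irrefl a

lex : (s : ℕ) {n : Fin s → ℕ} → Prod s n → Prod s n → Bool
lex zero x y = false
lex (suc s) x y = (x zero <ᵇ y zero) ∨ ((x zero ≟ᵇ y zero) ∧ lex s (λ i → x (suc i)) (λ i → y (suc i)))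

lex-irrefl : (s : ℕ) {n : Fin s → ℕ} (x y : Prod s n) → eqV s x y ≡ true → lex s x y ≡ false
lex-irrefl zero x y e = refl
lex-irrefl (suc s) x y e rewrite eqV-sound (suc s) x y e zero | <ᵇ-irrefl (y zero) | ≟ᵇ-refl (y zero) =
  lex-irrefl s (λ i → x (suc i)) (λ i → y (suc i)) (eqV-complete s _ _ (λ i → eqV-sound (suc s) x y e (suc i)))

lex-total : (s : ℕ) {n : Fin s → ℕ} (x y : Prod s n) → eqV s x y ≡ false → ⟦ lex s x y ⟧ + ⟦ lex s y x ⟧ ≡ 1ℤ
lex-total zero x y ()
lex-total (suc s) x y e with x zero ≟ᵇ y zero in e₀
... | false rewrite ≟ᵇ-sym (y zero) (x zero) | e₀ | ∨-identityʳ (x zero <ᵇ y zero) | ∨-identityʳ (y zero <ᵇ x zero) =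
  <ᵇ-total (x zero) (y zero) e₀
... | true rewrite ≟ᵇ-sound e₀ | <ᵇ-irrefl (y zero) | ≟ᵇ-refl (y zero) =
  lex-total s (λ i → x (suc i)) (λ i → y (suc i)) (trans (sym (all-tabulate s suc (λ i → x i ≟ᵇ y i))) e)

bool-ext : ∀ {a b} → (a ≡ true → b ≡ true) → (b ≡ true → a ≡ true) → a ≡ b
bool-ext {true} {true} _ _ = refl
bool-ext {false} {false} _ _ = refl
bool-ext {true} {false} a⇒b _ = sym (a⇒b refl)
bool-ext {false} {true} _ b⇒a = b⇒a refl

cayley-algebra : ∀ X N U P T₄ u c → T₄ ≡ N * (U * P) → u ≡ U → c ≡ N →
  X ≡ T₄ - N * (U * U) - N * (U * U - U) → X ≡ u * c * (+ 1 - + 2 * u + P)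
cayley-algebra X N U P T₄ u c refl refl refl refl = normalise N U P
  where normalise : ∀ N U P → N * (U * P) - N * (U * U) - N * (U * U - U) ≡ U * N * (+ 1 - + 2 * U + P)
        normalise = solve-∀

line-algebra : ∀ X N U P Q T₃ T₄ u c → T₃ ≡ N * (U * Q) → T₄ ≡ N * (U * P) → u ≡ U → c ≡ N →
  X ≡ T₄ + + 4 * (U - + 2) * T₃ + N * U * (U * (U - + 3) * (U - + 3) - + 5) →
  X ≡ u * c * (u * (u - + 3) * (u - + 3) - + 5 + + 4 * (u - + 2) * Q + P)
line-algebra X N U P Q T₃ T₄ u c refl refl refl refl refl = normalise N U P Q
  where normalise : ∀ N U P Q → N * (U * P) + + 4 * (U - + 2) * (N * (U * Q)) + N * U * (U * (U - + 3) * (U - + 3) - + 5)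
                                ≡ U * N * (U * (U - + 3) * (U - + 3) - + 5 + + 4 * (U - + 2) * Q + P)
        normalise = solve-∀

first : ∀ {s} → 1 ℕ.≤ s → Fin s
first {suc _} _ = zero

-- The unitary Cayley graph of R = R₁ × ⋯ × Rₛ (s ≥ 1, each Rᵢ local): its
-- adjacency is the product of the adjacencies of the G_{Rᵢ}, so it is a
-- regular graph whose parameters are products of the local ones.
module ProductRing (s : ℕ) (s≥1 : 1 ℕ.≤ s) (n : Fin s → ℕ) (R : (i : Fin s) → FinCRing (n i))
  (M : (i : Fin s) → Subset (n i)) (local : ∀ i → IsLocalWithMaximalIdeal (R i) (M i)) where

  module Rᵢ (i : Fin s) = LocalCounts (R i) (M i) (local i)

  Aᵢ : (i : Fin s) → Fin (n i) → Fin (n i) → ℤ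
  Aᵢ i a b = Rᵢ.u i (Rᵢ._−_ i a b)

  vs : List (Prod s n)
  vs = enumProd s n

  eq adj : Prod s n → Prod s n → Bool
  eq = eqP R
  adj = adjCayley R

  ⟦eq⟧≡∏ : ∀ x y → ⟦ eq x y ⟧ ≡ ∏ s (λ i → ⟦ x i ≟ᵇ y i ⟧)
  ⟦eq⟧≡∏ x y = ⟦all⟧≡∏ s (λ i → x i ≟ᵇ y i)

  delta : ∀ a → ∑ vs (λ y → ⟦ eq a y ⟧) ≡ 1ℤ
  delta a = trans (∑-cong vs (⟦eq⟧≡∏ a)) (trans (∑-∏ s n (λ i b → ⟦ a i ≟ᵇ b ⟧))
    (trans (∏-cong s (λ i → ∑-delta (n i) (a i))) (∏-1 s)))

  eq-refl : ∀ a → eq a a ≡ true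
  eq-refl a = eqV-complete s a a (λ i → refl)

  eq-sym : ∀ a b → eq a b ≡ eq b a
  eq-sym a b = bool-ext (λ e → eqV-complete s b a (λ i → sym (eqV-sound s a b e i)))
                        (λ e → eqV-complete s a b (λ i → sym (eqV-sound s b a e i)))

  eq-trans : ∀ a b c → eq a b ≡ true → eq b c ≡ true → eq a c ≡ true
  eq-trans a b c ab bc = eqV-complete s a c (λ i → trans (eqV-sound s a b ab i) (eqV-sound s b c bc i))

  unit-coordinates : (z : Prod s n) → isUnitPᵇ R z ≡ true → ∀ i → Rᵢ.isUnit i (z i) ≡ true
  unit-coordinates z e i with any-sound _ vs e
  ... | y , zy≡1 = Rᵢ.unit-complete i (z i) (y i) (eqV-sound s (mulP R z y) (oneP R) zy≡1 i)

  inverse : (z : Prod s n) → (∀ i → Rᵢ.isUnit i (z i) ≡ true) → Prod s n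
  inverse z h i = proj₁ (Rᵢ.unit-sound i (z i) (h i))

  unit-from-coordinates : (z : Prod s n) → (∀ i → Rᵢ.isUnit i (z i) ≡ true) → isUnitPᵇ R z ≡ true
  unit-from-coordinates z h with ∑⟦⟧≡1⇒witness vs (eq (inverse z h)) (delta (inverse z h))
  ... | y , y∈ , inverse≈y = any-complete (λ w → eqP R (mulP R z w) (oneP R)) vs y∈
    (eqV-complete s (mulP R z y) (oneP R) (λ i → trans (cong (FinCRing._*_ (R i) (z i)) (sym (eqV-sound s (inverse z h) y inverse≈y i)))
                                                       (proj₂ (Rᵢ.unit-sound i (z i) (h i)))))

  ⟦unit⟧≡∏ : ∀ z → ⟦ isUnitPᵇ R z ⟧ ≡ ∏ s (λ i → Rᵢ.u i (z i))
  ⟦unit⟧≡∏ z = trans (cong ⟦_⟧ (bool-ext (λ e → all-complete s _ (unit-coordinates z e)) (λ e → unit-from-coordinates z (all-sound s _ e))))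
                     (⟦all⟧≡∏ s (λ i → Rᵢ.isUnit i (z i)))

  ⟦adj⟧≡∏ : ∀ x y → ⟦ adj x y ⟧ ≡ ∏ s (λ i → Aᵢ i (x i) (y i))
  ⟦adj⟧≡∏ x y = ⟦unit⟧≡∏ (subP R x y)

  adj-sym : ∀ a b → adj a b ≡ adj b a
  adj-sym a b = ⟦⟧-injective (trans (⟦adj⟧≡∏ a b) (trans (∏-cong s (λ i → cong ⟦_⟧ (unit-anti i (a i) (b i)))) (sym (⟦adj⟧≡∏ b a))))
    where unit-anti : ∀ i x y → Rᵢ.isUnit i (Rᵢ._−_ i x y) ≡ Rᵢ.isUnit i (Rᵢ._−_ i y x)
          unit-anti i x y = trans (Rᵢ.unit⇔∉M i _) (trans (cong not (Rᵢ.inM-anti i x y)) (sym (Rᵢ.unit⇔∉M i _)))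

  adj-resp : ∀ a b c → eq a b ≡ true → adj a c ≡ adj b c
  adj-resp a b c e = ⟦⟧-injective (trans (⟦adj⟧≡∏ a c)
    (trans (∏-cong s (λ i → cong (λ z → Aᵢ i z (c i)) (eqV-sound s a b e i))) (sym (⟦adj⟧≡∏ b c))))

  -- no loops, since a − a is not a unit in the first factor
  adj-irr : ∀ a b → adj a b ≡ true → eq a b ≡ false
  adj-irr a b ab with eq a b in a≈b
  ... | false = refl
  ... | true = ⊥-elim (zero≢one (trans (sym (∏-0 s _ i₀ no-loop)) (trans (sym (⟦adj⟧≡∏ a b)) (cong ⟦_⟧ ab))))
    where
    i₀ : Fin s
    i₀ = first s≥1
    no-loop : Aᵢ i₀ (a i₀) (b i₀) ≡ 0ℤ
    no-loop = cong ⟦_⟧ (trans (cong (λ w → Rᵢ.isUnit i₀ (Rᵢ._−_ i₀ (a i₀) w)) (sym (eqV-sound s a b a≈b i₀))) (Rᵢ.self∉units i₀ (a i₀)))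
    zero≢one : ¬ (0ℤ ≡ 1ℤ)
    zero≢one ()

  U : ℤ
  U = ∏ s (λ i → Rᵢ.U i)

  regular : ∀ a → ∑ vs (λ b → ⟦ adj a b ⟧) ≡ U
  regular a = trans (∑-cong vs (⟦adj⟧≡∏ a)) (trans (∑-∏ s n (λ i b → Aᵢ i (a i) b)) (∏-cong s (λ i → Rᵢ.degree i (a i))))

  module G = RegularGraph vs eq adj eq-refl eq-sym eq-trans delta adj-sym adj-irr adj-resp U regular

  N≡∏ : G.N ≡ ∏ s (λ i → Rᵢ.N i)
  N≡∏ = trans (∑-cong vs (λ _ → sym (∏-1 s))) (trans (∑-∏ s n (λ i _ → 1ℤ)) (∏-cong s (λ i → ∑-allFin-1 (n i))))

  card≡N : + cardP R ≡ G.N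
  card≡N = length≡∑ vs

  unitCount≡U : + unitCountP R ≡ U
  unitCount≡U = trans (count≡∑ (isUnitPᵇ R) vs) (trans (∑-cong vs ⟦unit⟧≡∏)
    (trans (∑-∏ s n (λ i b → Rᵢ.u i b)) (∏-cong s (λ i → sym (count≡∑ (Rᵢ.isUnit i) (allFin (n i)))))))

  common≡∏ : ∀ a c → G.common a c ≡ ∏ s (λ i → Rᵢ.common i (a i) (c i))
  common≡∏ a c = trans (∑-cong vs (λ b → trans (cong₂ _*_ (⟦adj⟧≡∏ a b) (⟦adj⟧≡∏ b c)) (sym (∏-* s _ _))))
                      (∑-∏ s n (λ i b → Aᵢ i (a i) b * Aᵢ i b (c i)))

  P Q : ℤ
  P = ∏ s (λ i → Rᵢ.U i * Rᵢ.U i - Rᵢ.U i * Rᵢ.m i + Rᵢ.m i * Rᵢ.m i)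
  Q = ∏ s (λ i → Rᵢ.U i - Rᵢ.m i)

  T₄≡ : G.T₄ ≡ G.N * (U * P)
  T₄≡ = trans (∑-cong vs (λ a → trans (∑-cong vs (λ c → trans (cong (λ z → z * z) (common≡∏ a c)) (sym (∏-* s _ _))))
                                      (∑-∏ s n (λ i c → Rᵢ.common i (a i) c * Rᵢ.common i (a i) c))))
        (trans (∑-∏ s n (λ i a → ∑ (allFin (n i)) (λ c → Rᵢ.common i a c * Rᵢ.common i a c)))
        (trans (∏-cong s (λ i → Rᵢ.∑common² i))
               (trans (∏-* s _ _) (cong₂ _*_ (sym N≡∏) (∏-* s _ _)))))

  T₃≡ : G.T₃ ≡ G.N * (U * Q)
  T₃≡ = begin
      G.T₃
    ≡⟨ ∑-cong vs (λ a → ∑-swap vs vs (λ b c → G.A a b * (G.A b c * G.A c a))) ⟩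
      ∑ vs (λ a → ∑ vs (λ c → ∑ vs (λ b → G.A a b * (G.A b c * G.A c a))))
    ≡⟨ ∑-cong vs (λ a → ∑-cong vs (λ c → trans (∑-cong vs (λ b → rotate (G.A a b) (G.A b c) (G.A c a)))
         (trans (∑-*ˡ vs (G.A c a) _) (cong (_* G.common a c) (G.A-sym c a))))) ⟩
      ∑ vs (λ a → ∑ vs (λ c → G.A a c * G.common a c))
    ≡⟨ ∑-cong vs (λ a → trans (∑-cong vs (λ c → trans (cong₂ _*_ (⟦adj⟧≡∏ a c) (common≡∏ a c)) (sym (∏-* s _ _))))
         (∑-∏ s n (λ i c → Aᵢ i (a i) c * Rᵢ.common i (a i) c))) ⟩
      ∑ vs (λ a → ∏ s (λ i → ∑ (allFin (n i)) (λ c → Aᵢ i (a i) c * Rᵢ.common i (a i) c)))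
    ≡⟨ ∑-∏ s n (λ i a → ∑ (allFin (n i)) (λ c → Aᵢ i a c * Rᵢ.common i a c)) ⟩
      ∏ s (λ i → ∑ (allFin (n i)) (λ a → ∑ (allFin (n i)) (λ c → Aᵢ i a c * Rᵢ.common i a c)))
    ≡⟨ trans (∏-cong s (λ i → Rᵢ.∑triangles i)) (trans (∏-* s _ _) (cong₂ _*_ (sym N≡∏) (∏-* s _ _))) ⟩
      G.N * (U * Q) ∎
    where
    open ≡-Reasoning
    rotate : ∀ x y z → x * (y * z) ≡ z * (x * y)
    rotate = solve-∀

  -- lexicographic order on edges, for the eight-fold count in the line graph
  lexE : Prod s n × Prod s n → Prod s n × Prod s n → Bool
  lexE (x , y) (x' , y') = lex s x x' ∨ (eq x x' ∧ lex s y y')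

  lexE-total : ∀ e f → eqEdge eq e f ≡ false → ⟦ lexE e f ⟧ + ⟦ lexE f e ⟧ ≡ 1ℤ
  lexE-total (x , y) (x' , y') e≉f with eq x x' in x≈x'
  ... | false rewrite eq-sym x' x | x≈x' | ∨-identityʳ (lex s x x') | ∨-identityʳ (lex s x' x) = lex-total s x x' x≈x'
  ... | true rewrite eq-sym x' x | x≈x' | lex-irrefl s x x' x≈x' | lex-irrefl s x' x (trans (eq-sym x' x) x≈x') = lex-total s y y' e≉f

  cayley-count : + 8 * + n₄Cayley R ≡ + unitCountP R * + cardP R * (+ 1 - + 2 * + unitCountP R + P)
  cayley-count = cayley-algebra _ G.N U P G.T₄ _ _ T₄≡ unitCount≡U card≡N
    (trans (G.EightFold.eight-n₄ (lex s) (lex-total s)) G.closedWalks4-regular)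

  line-count : + 8 * + n₄LineCayley R ≡
    + unitCountP R * + cardP R * (+ unitCountP R * (+ unitCountP R - + 3) * (+ unitCountP R - + 3) - + 5 + + 4 * (+ unitCountP R - + 2) * Q + P)
  line-count = line-algebra _ G.N U P Q G.T₃ G.T₄ _ _ T₃≡ T₄≡ unitCount≡U card≡N
    (trans (G.LG.EightFold.eight-n₄ lexE lexE-total) G.closedWalks4-line)

corollary6p4 : (s : ℕ) → 1 ℕ.≤ s → (n : Fin s → ℕ) → (R : (i : Fin s) → FinCRing (n i))
      → (M : (i : Fin s) → Subset (n i))
      → (∀ i → IsLocalWithMaximalIdeal (R i) (M i))
      → (∀ i j → i Fin.≤ j → n i ℕ.* ∣ M j ∣ ℕ.≤ n j ℕ.* ∣ M i ∣)
      → ((+ 8) * (+ n₄Cayley R)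
          ≡ (+ unitCountP R) * (+ cardP R)
            * ((+ 1) - (+ 2) * (+ unitCountP R)
               + ∏ s (λ i → (+ unitCount (R i)) * (+ unitCount (R i))
                            - (+ unitCount (R i)) * (+ ∣ M i ∣)
                            + (+ ∣ M i ∣) * (+ ∣ M i ∣))))
        × ((+ 8) * (+ n₄LineCayley R)
          ≡ (+ unitCountP R) * (+ cardP R)
            * ((+ unitCountP R) * ((+ unitCountP R) - (+ 3)) * ((+ unitCountP R) - (+ 3))
               - (+ 5)
               + (+ 4) * ((+ unitCountP R) - (+ 2)) * ∏ s (λ i → (+ unitCount (R i)) - (+ ∣ M i ∣))
               + ∏ s (λ i → (+ unitCount (R i)) * (+ unitCount (R i))
                            - (+ unitCount (R i)) * (+ ∣ M i ∣)
                            + (+ ∣ M i ∣) * (+ ∣ M i ∣))))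
corollary6p4 s s≥1 n R M local _ = cayley-count , line-count
  where open ProductRing s s≥1 n R M local
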